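{- Let $A\in{\sf ASM}(n)$. Then (1) ${\tt Perm}(A)$ equals the set of minimal elements of $\{w\in\mathcal S_\infty:w\ge A\}$; (2) ${\tt Perm}(A)$ equals the set of minimal elements of $\{w\in{\sf P}(n):w\ge A\}$.
   Context: ASMs: square matrices with entries in $\{ -1,0,1\}$ whose nonzero entries alternate in sign along rows and columns and whose rows and columns sum to 1; ${\sf ASM}(n)$ the $n\times n$ ones. $r_A(i,j)=\sum_{k\le i,l\le j}a_{kl}$; $A\le B$ iff $r_A\ge r_B$ entrywise. Permutations are identified with permutation matrices (1 at $(i,w(i))$); $\mathcal S_\infty=\bigcup_n\mathcal S_n$ with $\mathcal S_n\subset\mathcal S_{n+1}$ and ${\sf ASM}(n)\subset{\sf ASM}(n+1)$ via $A\mapsto{\rm diag}(A,1)$, which preserves the order. ${\tt Perm}(A)$ is the set of minimal elements of $\{w\in\mathcal S_n:w\ge A\}$. ${\sf P}(n)$ is the set of $n\times n$ partial permutation matrices ($0/1$ matrices with at most one $1$ in each row and column); partial permutations and ASMs in ${\sf ASM}(n)$ are compared by the same rule $A\le B$ iff $r_A\ge r_B$ entrywise on $[n]\times[n]$. -}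

module Defs where

open import Data.Nat as ℕ using (ℕ; zero; suc; _⊔_)
open import Data.Fin using (Fin; zero; suc; toℕ; fromℕ<; _<_)
open import Data.Fin.Permutation using (Permutation′; _⟨$⟩ʳ_)
open import Data.Integer as ℤ using (ℤ; 0ℤ; 1ℤ; -1ℤ; -_; _+_)
open import Data.Bool using (if_then_else_)
open import Data.Product using (Σ; _×_; _,_)
open import Data.Sum using (_⊎_)
open import Relation.Nullary using (¬_; yes; no)
open import Relation.Nullary.Decidable using (⌊_⌋)
open import Relation.Binary.PropositionalEquality using (_≡_)
import Data.Fin as F
import Data.Nat.Properties as ℕP

-- n×n integer matrices, rows/columns indexed by Fin n (0-based).
Mat : ℕ → Set
Mat n = Fin n → Fin n → ℤ

sumFin : ∀ {n} → (Fin n → ℤ) → ℤ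
sumFin {zero} f = 0ℤ
sumFin {suc n} f = f zero + sumFin (λ k → f (suc k))

rk : ∀ {n} → Mat n → Fin n → Fin n → ℤ
rk X i j = sumFin (λ k → sumFin (λ l →
  if ⌊ toℕ k ℕ.≤? toℕ i ⌋ then (if ⌊ toℕ l ℕ.≤? toℕ j ⌋ then X k l else 0ℤ) else 0ℤ))

_≤M_ : ∀ {n} → Mat n → Mat n → Set
X ≤M Y = ∀ i j → rk Y i j ℤ.≤ rk X i j

_≡M_ : ∀ {n} → Mat n → Mat n → Set
X ≡M Y = ∀ i j → X i j ≡ Y i j

IsASM : ∀ {n} → Mat n → Set
IsASM {n} X =
  (∀ i j → X i j ≡ 0ℤ ⊎ (X i j ≡ 1ℤ ⊎ X i j ≡ -1ℤ))
  × (∀ i → sumFin (λ j → X i j) ≡ 1ℤ)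
  × (∀ j → sumFin (λ i → X i j) ≡ 1ℤ)
  × (∀ i j j' → j < j' → ¬ X i j ≡ 0ℤ → ¬ X i j' ≡ 0ℤ →
       (∀ l → j < l → l < j' → X i l ≡ 0ℤ) → X i j' ≡ - X i j)
  × (∀ j i i' → i < i' → ¬ X i j ≡ 0ℤ → ¬ X i' j ≡ 0ℤ →
       (∀ l → i < l → l < i' → X l j ≡ 0ℤ) → X i' j ≡ - X i j)

permMat : ∀ {n} → Permutation′ n → Mat n
permMat w i j = if ⌊ w ⟨$⟩ʳ i F.≟ j ⌋ then 1ℤ else 0ℤ

IsPermMat : ∀ {n} → Mat n → Set
IsPermMat {n} X = Σ (Permutation′ n) (λ w → permMat w ≡M X)

IsPartialPerm : ∀ {n} → Mat n → Set
IsPartialPerm {n} X =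
  (∀ i j → X i j ≡ 0ℤ ⊎ X i j ≡ 1ℤ)
  × (∀ i j j' → X i j ≡ 1ℤ → X i j' ≡ 1ℤ → j ≡ j')
  × (∀ j i i' → X i j ≡ 1ℤ → X i' j ≡ 1ℤ → i ≡ i')

MinIn : ∀ {n} → (Mat n → Set) → Mat n → Set
MinIn {n} P X = P X × (∀ (Y : Mat n) → P Y → Y ≤M X → Y ≡M X)

InPerm : ∀ {n} → Mat n → Mat n → Set
InPerm A = MinIn (λ W → IsPermMat W × A ≤M W)

-- Embedding of an a×a matrix into size N (N ≥ a): X ↦ diag(X, I_{N-a}),
-- i.e. the iterate of X ↦ diag(X,1).
extTo : ∀ {a} (N : ℕ) → Mat a → Mat N
extTo {a} N X i j with toℕ i ℕ.<? a | toℕ j ℕ.<? a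
... | yes p | yes q = X (fromℕ< p) (fromℕ< q)
... | _ | _ = if ⌊ toℕ i ℕ.≟ toℕ j ⌋ then 1ℤ else 0ℤ

-- Elements of the direct limit ⋃_a Mat a, given as (size, matrix).
Fam : Set
Fam = Σ ℕ Mat

_≤∞_ : Fam → Fam → Set
(a , X) ≤∞ (b , Y) = extTo (a ⊔ b) X ≤M extTo (a ⊔ b) Y

_≈∞_ : Fam → Fam → Set
(a , X) ≈∞ (b , Y) = extTo (a ⊔ b) X ≡M extTo (a ⊔ b) Y

InS∞ : Fam → Set
InS∞ (a , X) = IsPermMat X

MinS∞Above : Fam → Fam → Set
MinS∞Above A W = (InS∞ W × A ≤∞ W)
  × (∀ V → InS∞ V → A ≤∞ V → V ≤∞ W → V ≈∞ W)

module Submission where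

-- Both parts rest on one filling theorem: every partial permutation M ∈ P(n)
-- with M ≥ A lies above a permutation v ∈ S_n with v ≥ A.  An ASM satisfies k + l ≤ r_A(k, l) + n, since its column prefix
-- sums are ≤ 1.  As long as M has an empty row, a one can be added, or an
-- existing one moved left, so that the rank function of M grows while staying
-- below that of A; the integer Σ (r_A − r_M) bounds the number of such steps.
--
-- Part (2) follows at once: a permutation is a partial permutation, and any
-- partial permutation above A dominates a permutation above A.  For part (1)
-- we represent w ∈ S_m by its embedding diag(w, 1, 1, …); filling the n × n
-- corner of such a w ≥ A yields v ∈ S_n with A ≤ v ≤ w, so the minimal
-- elements of S_∞ above A are exactly those coming from Perm(A).

open import Defs
open import Data.Nat as ℕ using (ℕ; zero; suc; _⊔_; _⊓_; z≤n; s≤s; _∸_)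
import Data.Nat.Properties as ℕP
open import Data.Integer as ℤ using (ℤ; 0ℤ; 1ℤ; +_; -_; _+_; _-_)
import Data.Integer.Properties as ℤP
open import Data.Integer.Tactic.RingSolver using (solve-∀)
open import Relation.Binary.PropositionalEquality hiding ([_])
open import Data.Product using (Σ; ∃; _×_; _,_; proj₁; proj₂)
open import Data.Sum using (_⊎_; inj₁; inj₂; [_,_]; [_,_]′)
open import Data.Bool using (if_then_else_)
open import Relation.Nullary using (¬_; Dec; yes; no; ¬?)
open import Relation.Nullary.Decidable using (⌊_⌋; _×-dec_; map′; decidable-stable)
open import Data.Empty using (⊥-elim)
open import Function using (_∘_)
open import Function.Bundles using (_⇔_; mk⇔)
open import Data.Fin as F using (Fin; zero; suc; toℕ; fromℕ<)
import Data.Fin.Properties as FP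
open import Data.Fin.Permutation using (Permutation′; _⟨$⟩ʳ_; _⟨$⟩ˡ_; inverseˡ; inverseʳ; permutation)

IMat : Set
IMat = ℕ → ℕ → ℤ

Σ< : ℕ → (ℕ → ℤ) → ℤ
Σ< zero f = 0ℤ
Σ< (suc k) f = Σ< k f + f k

-- The rank function: rank M k l is the sum of the entries of the k × l
-- upper-left corner of M (so r_X(i,j) of the paper is rank X (1+i) (1+j)).
rank : IMat → ℕ → ℕ → ℤ
rank M k l = Σ< k (λ a → Σ< l (M a))

0≢1 : 0ℤ ≢ 1ℤ
0≢1 ()

¬1≤0 : ¬ (1ℤ ℤ.≤ 0ℤ)
¬1≤0 (ℤ.+≤+ ())

≤∧≢⇒1+≤ : ∀ {a b : ℤ} → a ℤ.≤ b → a ≢ b → 1ℤ + a ℤ.≤ b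
≤∧≢⇒1+≤ p q = ℤP.i<j⇒suc[i]≤j (ℤP.≤∧≢⇒< p q)

+-cancelˡ-≤ : ∀ x {a b} → x + a ℤ.≤ x + b → a ℤ.≤ b
+-cancelˡ-≤ x {a} {b} h = subst₂ ℤ._≤_ (lem x a) (lem x b) (ℤP.+-monoʳ-≤ (- x) h)
  where lem : ∀ x a → - x + (x + a) ≡ a
        lem = solve-∀

+-cancelʳ-≤ : ∀ x {a b} → a + x ℤ.≤ b + x → a ℤ.≤ b
+-cancelʳ-≤ x {a} {b} h = +-cancelˡ-≤ x (subst₂ ℤ._≤_ (ℤP.+-comm a x) (ℤP.+-comm b x) h)

+-cancelʳ-≡ : ∀ x {a b} → a + x ≡ b + x → a ≡ b
+-cancelʳ-≡ x e = ℤP.≤-antisym (+-cancelʳ-≤ x (ℤP.≤-reflexive e)) (+-cancelʳ-≤ x (ℤP.≤-reflexive (sym e)))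

+1-pos : ∀ k → + k + 1ℤ ≡ + suc k
+1-pos k = trans (sym (ℤP.pos-+ k 1)) (cong +_ (ℕP.+-comm k 1))

Σ<-cong : ∀ k {f g : ℕ → ℤ} → (∀ a → a ℕ.< k → f a ≡ g a) → Σ< k f ≡ Σ< k g
Σ<-cong zero h = refl
Σ<-cong (suc k) h = cong₂ _+_ (Σ<-cong k (λ a p → h a (ℕP.m<n⇒m<1+n p))) (h k ℕP.≤-refl)

Σ<-+ : ∀ k (f g : ℕ → ℤ) → Σ< k (λ a → f a + g a) ≡ Σ< k f + Σ< k g
Σ<-+ zero f g = refl
Σ<-+ (suc k) f g rewrite Σ<-+ k f g = lem (Σ< k f) (Σ< k g) (f k) (g k)
  where lem : ∀ a b c d → a + b + (c + d) ≡ a + c + (b + d)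
        lem = solve-∀

Σ<-neg : ∀ k (f : ℕ → ℤ) → Σ< k (λ a → - f a) ≡ - Σ< k f
Σ<-neg zero f = refl
Σ<-neg (suc k) f rewrite Σ<-neg k f = sym (ℤP.neg-distrib-+ (Σ< k f) (f k))

Σ<-diff : ∀ k (f g : ℕ → ℤ) → Σ< k (λ a → f a - g a) ≡ Σ< k f - Σ< k g
Σ<-diff k f g = trans (Σ<-+ k f (λ a → - g a)) (cong (_+_ (Σ< k f)) (Σ<-neg k g))

Σ<-zero : ∀ k → Σ< k (λ _ → 0ℤ) ≡ 0ℤ
Σ<-zero zero = refl
Σ<-zero (suc k) rewrite Σ<-zero k = refl

Σ<-vanish : ∀ k (f : ℕ → ℤ) → (∀ a → a ℕ.< k → f a ≡ 0ℤ) → Σ< k f ≡ 0ℤ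
Σ<-vanish k f h = trans (Σ<-cong k h) (Σ<-zero k)

Σ<-swap : ∀ k l (f : ℕ → ℕ → ℤ) → Σ< k (λ a → Σ< l (f a)) ≡ Σ< l (λ b → Σ< k (λ a → f a b))
Σ<-swap zero l f = sym (Σ<-zero l)
Σ<-swap (suc k) l f rewrite Σ<-swap k l f = sym (Σ<-+ l (λ b → Σ< k (λ a → f a b)) (f k))

Σ<-mono : ∀ k {f g : ℕ → ℤ} → (∀ a → a ℕ.< k → f a ℤ.≤ g a) → Σ< k f ℤ.≤ Σ< k g
Σ<-mono zero h = ℤP.≤-refl
Σ<-mono (suc k) h = ℤP.+-mono-≤ (Σ<-mono k (λ a p → h a (ℕP.m<n⇒m<1+n p))) (h k ℕP.≤-refl)

Σ<-strict : ∀ k (f g : ℕ → ℤ) c → c ℕ.< k → (∀ a → a ℕ.< k → f a ℤ.≤ g a) →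
  1ℤ + f c ℤ.≤ g c → 1ℤ + Σ< k f ℤ.≤ Σ< k g
Σ<-strict (suc k) f g c c<k h hc with c ℕ.≟ k
... | yes refl = subst₂ ℤ._≤_ (lem (Σ< c f) (f c)) refl
      (ℤP.+-mono-≤ (Σ<-mono c (λ a p → h a (ℕP.m<n⇒m<1+n p))) hc)
  where lem : ∀ s x → s + (1ℤ + x) ≡ 1ℤ + (s + x)
        lem = solve-∀
... | no c≢ = subst₂ ℤ._≤_ (ℤP.+-assoc 1ℤ (Σ< k f) (f k)) refl
      (ℤP.+-mono-≤ (Σ<-strict k f g c (ℕP.≤∧≢⇒< (ℕP.≤-pred c<k) c≢) (λ a p → h a (ℕP.m<n⇒m<1+n p)) hc)
                   (h k ℕP.≤-refl))

Σ<-countFrom : ∀ l n (f : ℕ → ℤ) → l ℕ.≤ n → (∀ a → l ℕ.≤ a → a ℕ.< n → f a ℤ.≤ 1ℤ) →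
  Σ< n f ℤ.≤ Σ< l f + + (n ∸ l)
Σ<-countFrom l zero f z≤n h = ℤP.≤-reflexive (sym (ℤP.+-identityʳ _))
Σ<-countFrom l (suc n) f l≤ h with l ℕ.≟ suc n
... | yes refl rewrite ℕP.n∸n≡0 (suc n) = ℤP.≤-reflexive (sym (ℤP.+-identityʳ _))
... | no l≢ = ℤP.≤-trans
      (ℤP.+-mono-≤ (Σ<-countFrom l n f l≤n (λ a p q → h a p (ℕP.m<n⇒m<1+n q))) (h n l≤n ℕP.≤-refl))
      (ℤP.≤-reflexive (trans (ℤP.+-assoc (Σ< l f) _ _)
        (cong (_+_ (Σ< l f)) (trans (+1-pos (n ∸ l)) (cong +_ (sym (ℕP.+-∸-assoc 1 l≤n)))))))
  where l≤n = ℕP.≤-pred (ℕP.≤∧≢⇒< l≤ l≢)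

Σ<-count : ∀ k (f : ℕ → ℤ) → (∀ a → a ℕ.< k → f a ℤ.≤ 1ℤ) → Σ< k f ℤ.≤ + k
Σ<-count k f h = subst₂ ℤ._≤_ refl (ℤP.+-identityˡ (+ k)) (Σ<-countFrom 0 k f z≤n (λ a _ → h a))

Σ<-countStrict : ∀ k (f : ℕ → ℤ) i → i ℕ.< k → f i ≡ 0ℤ → (∀ a → a ℕ.< k → f a ℤ.≤ 1ℤ) →
  1ℤ + Σ< k f ℤ.≤ + k
Σ<-countStrict (suc k) f i i<k fi h with i ℕ.≟ k
... | yes refl rewrite fi = subst₂ ℤ._≤_ (cong (_+_ 1ℤ) (sym (ℤP.+-identityʳ (Σ< i f))))
      (trans (ℤP.+-comm 1ℤ (+ i)) (+1-pos i))
      (ℤP.+-monoʳ-≤ 1ℤ (Σ<-count i f (λ a p → h a (ℕP.m<n⇒m<1+n p))))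
... | no i≢ = subst₂ ℤ._≤_ (ℤP.+-assoc 1ℤ (Σ< k f) (f k)) (+1-pos k)
      (ℤP.+-mono-≤ (Σ<-countStrict k f i (ℕP.≤∧≢⇒< (ℕP.≤-pred i<k) i≢) fi (λ a p → h a (ℕP.m<n⇒m<1+n p)))
                   (h k ℕP.≤-refl))

Σ<-padZeros : ∀ k n (f : ℕ → ℤ) → k ℕ.≤ n → (∀ a → k ℕ.≤ a → a ℕ.< n → f a ≡ 0ℤ) → Σ< n f ≡ Σ< k f
Σ<-padZeros k zero f z≤n h = refl
Σ<-padZeros k (suc n) f k≤ h with k ℕ.≟ suc n
... | yes refl = refl
... | no k≢ = trans (cong₂ _+_ (Σ<-padZeros k n f k≤n (λ a p q → h a p (ℕP.m<n⇒m<1+n q))) (h n k≤n ℕP.≤-refl))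
                    (ℤP.+-identityʳ _)
  where k≤n = ℕP.≤-pred (ℕP.≤∧≢⇒< k≤ k≢)

Σ<-padOnes : ∀ k n (f : ℕ → ℤ) → k ℕ.≤ n → (∀ a → k ℕ.≤ a → a ℕ.< n → f a ≡ 1ℤ) →
  Σ< n f ≡ Σ< k f + + (n ∸ k)
Σ<-padOnes k zero f z≤n h = sym (ℤP.+-identityʳ _)
Σ<-padOnes k (suc n) f k≤ h with k ℕ.≟ suc n
... | yes refl rewrite ℕP.n∸n≡0 (suc n) = sym (ℤP.+-identityʳ _)
... | no k≢ = begin
    Σ< n f + f n             ≡⟨ cong₂ _+_ (Σ<-padOnes k n f k≤n (λ a p q → h a p (ℕP.m<n⇒m<1+n q)))
                                          (h n k≤n ℕP.≤-refl) ⟩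
    Σ< k f + + (n ∸ k) + 1ℤ  ≡⟨ ℤP.+-assoc (Σ< k f) _ _ ⟩
    Σ< k f + (+ (n ∸ k) + 1ℤ) ≡⟨ cong (_+_ (Σ< k f)) (trans (+1-pos (n ∸ k)) (cong +_ (sym (ℕP.+-∸-assoc 1 k≤n)))) ⟩
    Σ< k f + + (suc n ∸ k)   ∎
  where k≤n = ℕP.≤-pred (ℕP.≤∧≢⇒< k≤ k≢)
        open ≡-Reasoning

Σ<-nonzero : ∀ k n (f : ℕ → ℤ) → k ℕ.≤ n → Σ< n f ≢ Σ< k f → ∃ λ a → k ℕ.≤ a × a ℕ.< n × f a ≢ 0ℤ
Σ<-nonzero k zero f z≤n ne = ⊥-elim (ne refl)
Σ<-nonzero k (suc n) f k≤ ne with k ℕ.≟ suc n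
... | yes refl = ⊥-elim (ne refl)
... | no k≢ with f n ℤ.≟ 0ℤ
...   | no fn≢ = n , k≤n , ℕP.≤-refl , fn≢
  where k≤n = ℕP.≤-pred (ℕP.≤∧≢⇒< k≤ k≢)
...   | yes fn≡ with Σ<-nonzero k n f (ℕP.≤-pred (ℕP.≤∧≢⇒< k≤ k≢))
                      (λ e → ne (trans (cong (_+_ (Σ< n f)) fn≡) (trans (ℤP.+-identityʳ _) e)))
...     | a , p , q , r = a , p , ℕP.m<n⇒m<1+n q , r

Σ<-truncate : ∀ k n (f : ℕ → ℤ) → (∀ a → n ℕ.≤ a → f a ≡ 0ℤ) → Σ< k f ≡ Σ< (k ⊓ n) f
Σ<-truncate k n f h with ℕP.≤-total k n
... | inj₁ k≤n rewrite ℕP.m≤n⇒m⊓n≡m k≤n = refl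
... | inj₂ n≤k rewrite ℕP.m≥n⇒m⊓n≡n n≤k = Σ<-padZeros n k f n≤k (λ a p _ → h a p)

Σ<-shift : ∀ n (f : ℕ → ℤ) → Σ< (suc n) f ≡ f 0 + Σ< n (λ a → f (suc a))
Σ<-shift zero f = trans (ℤP.+-identityˡ (f 0)) (sym (ℤP.+-identityʳ (f 0)))
Σ<-shift (suc n) f = trans (cong (_+ f (suc n)) (Σ<-shift n f)) (ℤP.+-assoc (f 0) _ _)

δ : ℕ → ℕ → ℤ → ℤ
δ i a c = if ⌊ i ℕ.≟ a ⌋ then c else 0ℤ

δ-refl : ∀ a (c : ℤ) → δ a a c ≡ c
δ-refl a c with a ℕ.≟ a
... | yes _ = refl
... | no ne = ⊥-elim (ne refl)

δ-≢ : ∀ a b (c : ℤ) → a ≢ b → δ a b c ≡ 0ℤ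
δ-≢ a b c ne with a ℕ.≟ b
... | yes e = ⊥-elim (ne e)
... | no _ = refl

δ-1 : ∀ a b → δ a b 1ℤ ≡ 1ℤ → a ≡ b
δ-1 a b e with a ℕ.≟ b
... | yes p = p
... | no _ = ⊥-elim (0≢1 e)

δ-01 : ∀ a b → δ a b 1ℤ ≡ 0ℤ ⊎ δ a b 1ℤ ≡ 1ℤ
δ-01 a b with a ℕ.≟ b
... | yes _ = inj₂ refl
... | no _ = inj₁ refl

Σ<-δ-in : ∀ k i c → i ℕ.< k → Σ< k (λ a → δ i a c) ≡ c
Σ<-δ-in (suc k) i c i<k with i ℕ.≟ k
... | yes refl = trans (cong (_+ c) (Σ<-vanish k _ (λ a p → δ-≢ i a c (λ e → ℕP.<-irrefl (sym e) p))))
                       (ℤP.+-identityˡ c)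
... | no i≢k = trans (ℤP.+-identityʳ _) (Σ<-δ-in k i c (ℕP.≤∧≢⇒< (ℕP.≤-pred i<k) i≢k))

Σ<-δ-out : ∀ k i c → k ℕ.≤ i → Σ< k (λ a → δ i a c) ≡ 0ℤ
Σ<-δ-out k i c k≤i = Σ<-vanish k _ (λ a p → δ-≢ i a c (λ e → ℕP.<-irrefl (sym e) (ℕP.<-≤-trans p k≤i)))

rank-zeroCols : ∀ M k → rank M k 0 ≡ 0ℤ
rank-zeroCols M k = Σ<-zero k

rank-cong : ∀ (M N : IMat) → (∀ a b → M a b ≡ N a b) → ∀ k l → rank M k l ≡ rank N k l
rank-cong M N h k l = Σ<-cong k (λ a _ → Σ<-cong l (λ b _ → h a b))

rank-+ : ∀ (M N : IMat) k l → rank (λ a b → M a b + N a b) k l ≡ rank M k l + rank N k l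
rank-+ M N k l = trans (Σ<-cong k (λ a _ → Σ<-+ l (M a) (N a))) (Σ<-+ k _ _)

rank-byColumns : ∀ M k l → rank M k l ≡ Σ< l (λ b → Σ< k (λ a → M a b))
rank-byColumns M k l = Σ<-swap k l M

entry-rank : ∀ M a b → M a b ≡ (rank M (suc a) (suc b) - rank M a (suc b)) - (rank M (suc a) b - rank M a b)
entry-rank M a b = sym (lem (rank M a (suc b)) (rank M a b) (Σ< b (M a)) (M a b))
  where
  lem : ∀ x r s m → (x + (s + m) - x) - ((r + s) - r) ≡ m
  lem = solve-∀

rank-injective : ∀ (M N : IMat) → (∀ k l → rank M k l ≡ rank N k l) → ∀ a b → M a b ≡ N a b
rank-injective M N h a b = begin
  M a b                                                                    ≡⟨ entry-rank M a b ⟩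
  (rank M (suc a) (suc b) - rank M a (suc b)) - (rank M (suc a) b - rank M a b)
    ≡⟨ cong₂ _-_ (cong₂ _-_ (h (suc a) (suc b)) (h a (suc b))) (cong₂ _-_ (h (suc a) b) (h a b)) ⟩
  (rank N (suc a) (suc b) - rank N a (suc b)) - (rank N (suc a) b - rank N a b) ≡⟨ sym (entry-rank N a b) ⟩
  N a b                                                                    ∎
  where open ≡-Reasoning

-- set M a b c replaces the entry at (a, b) by c.  Its rank function changes
-- by c - M a b exactly on the quadrant {(k, l) : a < k, b < l}.
set : IMat → ℕ → ℕ → ℤ → IMat
set M a b c x y = if ⌊ a ℕ.≟ x ⌋ then (if ⌊ b ℕ.≟ y ⌋ then c else M x y) else M x y

set-cases : ∀ M a b c x y → (a ≡ x × b ≡ y × set M a b c x y ≡ c) ⊎ ((a ≢ x ⊎ b ≢ y) × set M a b c x y ≡ M x y)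
set-cases M a b c x y with a ℕ.≟ x | b ℕ.≟ y
... | yes refl | yes refl = inj₁ (refl , refl , refl)
... | yes p | no q = inj₂ (inj₂ q , refl)
... | no p | _ = inj₂ (inj₁ p , refl)

set-miss : ∀ M a b c x y → (a ≢ x ⊎ b ≢ y) → set M a b c x y ≡ M x y
set-miss M a b c x y o with set-cases M a b c x y
... | inj₁ (refl , refl , _) = ⊥-elim ([ (λ z → z refl) , (λ z → z refl) ] o)
... | inj₂ (_ , e) = e

set-asSum : ∀ M a b c x y → set M a b c x y ≡ M x y + δ a x (δ b y (c - M a b))
set-asSum M a b c x y with a ℕ.≟ x | b ℕ.≟ y
... | yes refl | yes refl = sym (lem c (M a b))
  where lem : ∀ c m → m + (c - m) ≡ c
        lem = solve-∀
... | yes refl | no _ = sym (ℤP.+-identityʳ _)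
... | no _ | _ = sym (ℤP.+-identityʳ _)

rank-point-in : ∀ a b c k l → a ℕ.< k → b ℕ.< l → rank (λ x y → δ a x (δ b y c)) k l ≡ c
rank-point-in a b c k l p q =
  trans (trans (Σ<-cong k lem) (Σ<-δ-in k a (Σ< l (λ y → δ b y c)) p)) (Σ<-δ-in l b c q)
  where
  lem : ∀ x → x ℕ.< k → Σ< l (λ y → δ a x (δ b y c)) ≡ δ a x (Σ< l (λ y → δ b y c))
  lem x _ with a ℕ.≟ x
  ... | yes refl = refl
  ... | no _ = Σ<-zero l

rank-point-out : ∀ a b c k l → (k ℕ.≤ a ⊎ l ℕ.≤ b) → rank (λ x y → δ a x (δ b y c)) k l ≡ 0ℤ
rank-point-out a b c k l o = Σ<-vanish k _ lem
  where
  lem : ∀ x → x ℕ.< k → Σ< l (λ y → δ a x (δ b y c)) ≡ 0ℤ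
  lem x p with a ℕ.≟ x
  ... | no _ = Σ<-zero l
  ... | yes refl = [ (λ k≤a → ⊥-elim (ℕP.<-irrefl refl (ℕP.<-≤-trans p k≤a))) , Σ<-δ-out l b c ] o

rank-set : ∀ M a b c k l → rank (set M a b c) k l ≡ rank M k l + rank (λ x y → δ a x (δ b y (c - M a b))) k l
rank-set M a b c k l = trans (rank-cong _ _ (set-asSum M a b c) k l) (rank-+ M _ k l)

rank-set-in : ∀ M a b c k l → a ℕ.< k → b ℕ.< l → rank (set M a b c) k l ≡ rank M k l + (c - M a b)
rank-set-in M a b c k l p q = trans (rank-set M a b c k l) (cong (_+_ (rank M k l)) (rank-point-in a b _ k l p q))

rank-set-out : ∀ M a b c k l → (k ℕ.≤ a ⊎ l ℕ.≤ b) → rank (set M a b c) k l ≡ rank M k l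
rank-set-out M a b c k l o = trans (rank-set M a b c k l)
  (trans (cong (_+_ (rank M k l)) (rank-point-out a b _ k l o)) (ℤP.+-identityʳ _))

Supp : ℕ → IMat → Set
Supp n M = ∀ a b → (n ℕ.≤ a ⊎ n ℕ.≤ b) → M a b ≡ 0ℤ

rank-truncate : ∀ n M k l → Supp n M → rank M k l ≡ rank M (k ⊓ n) (l ⊓ n)
rank-truncate n M k l sp = trans (Σ<-cong k (λ a _ → Σ<-truncate l n (M a) (λ b p → sp a b (inj₂ p))))
  (Σ<-truncate k n _ (λ a p → Σ<-vanish (l ⊓ n) _ (λ b _ → sp a b (inj₁ p))))

lastBelow : ∀ (P : ℕ → Set) → (∀ a → Dec (P a)) → ∀ n →
  (∃ λ a → a ℕ.< n × P a × (∀ a' → a ℕ.< a' → a' ℕ.< n → ¬ P a')) ⊎ (∀ a → a ℕ.< n → ¬ P a)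
lastBelow P P? zero = inj₂ (λ a ())
lastBelow P P? (suc n) with P? n | lastBelow P P? n
... | yes p | _ = inj₁ (n , ℕP.≤-refl , p , λ a' n<a' a'<sn → ⊥-elim (ℕP.<-irrefl refl (ℕP.<-≤-trans n<a' (ℕP.≤-pred a'<sn))))
... | no ¬p | inj₁ (a , a<n , pa , later) = inj₁ (a , ℕP.m<n⇒m<1+n a<n , pa , later')
  where later' : ∀ a' → a ℕ.< a' → a' ℕ.< suc n → ¬ P a'
        later' a' p q with a' ℕ.≟ n
        ... | yes refl = ¬p
        ... | no a'≢ = later a' p (ℕP.≤∧≢⇒< (ℕP.≤-pred q) a'≢)
... | no ¬p | inj₂ none = inj₂ none'
  where none' : ∀ a → a ℕ.< suc n → ¬ P a
        none' a q with a ℕ.≟ n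
        ... | yes refl = ¬p
        ... | no a≢ = none a (ℕP.≤∧≢⇒< (ℕP.≤-pred q) a≢)

allBelow? : ∀ (P : ℕ → Set) → (∀ a → Dec (P a)) → ∀ n → Dec (∀ a → a ℕ.< n → P a)
allBelow? P P? n = map′ (λ h a p → h p) (λ h {a} p → h a p) (ℕP.allUpTo? P? n)

module OneHot (f : ℕ → ℤ) (zeroOne : ∀ b → f b ≡ 0ℤ ⊎ f b ≡ 1ℤ)
              (unique : ∀ b b' → f b ≡ 1ℤ → f b' ≡ 1ℤ → b ≡ b') where

  zerosBefore : ∀ l → f l ≡ 1ℤ → Σ< l f ≡ 0ℤ
  zerosBefore l fl = Σ<-vanish l f λ b b<l →
    [ (λ z → z) , (λ fb → ⊥-elim (ℕP.<-irrefl (unique b l fb fl) b<l)) ] (zeroOne b)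

  prefix≤1 : ∀ l → Σ< l f ℤ.≤ 1ℤ
  prefix≤1 zero = ℤ.+≤+ z≤n
  prefix≤1 (suc l) with zeroOne l
  ... | inj₁ fl0 rewrite fl0 | ℤP.+-identityʳ (Σ< l f) = prefix≤1 l
  ... | inj₂ fl1 rewrite fl1 | zerosBefore l fl1 = ℤP.≤-refl

  prefix≡1 : ∀ l b → b ℕ.< l → f b ≡ 1ℤ → Σ< l f ≡ 1ℤ
  prefix≡1 (suc l) b b<l fb with b ℕ.≟ l
  ... | yes refl rewrite zerosBefore b fb = trans (ℤP.+-identityˡ _) fb
  ... | no b≢l with zeroOne l
  ...   | inj₁ fl0 = trans (cong₂ _+_ (prefix≡1 l b (ℕP.≤∧≢⇒< (ℕP.≤-pred b<l) b≢l) fb) fl0) refl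
  ...   | inj₂ fl1 = ⊥-elim (b≢l (unique b l fb fl1))

record PartialPerm (M : IMat) : Set where
  field
    zeroOne : ∀ a b → M a b ≡ 0ℤ ⊎ M a b ≡ 1ℤ
    rowUnique : ∀ a b b' → M a b ≡ 1ℤ → M a b' ≡ 1ℤ → b ≡ b'
    colUnique : ∀ b a a' → M a b ≡ 1ℤ → M a' b ≡ 1ℤ → a ≡ a'

  rowPrefix≤1 : ∀ a l → Σ< l (M a) ℤ.≤ 1ℤ
  rowPrefix≤1 a = OneHot.prefix≤1 (M a) (zeroOne a) (rowUnique a)

  colPrefix≤1 : ∀ b k → Σ< k (λ a → M a b) ℤ.≤ 1ℤ
  colPrefix≤1 b = OneHot.prefix≤1 (λ a → M a b) (λ a → zeroOne a b) (colUnique b)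

  rowSum≡1 : ∀ a l b → b ℕ.< l → M a b ≡ 1ℤ → Σ< l (M a) ≡ 1ℤ
  rowSum≡1 a = OneHot.prefix≡1 (M a) (zeroOne a) (rowUnique a)

  colSum≡1 : ∀ b k a → a ℕ.< k → M a b ≡ 1ℤ → Σ< k (λ x → M x b) ≡ 1ℤ
  colSum≡1 b = OneHot.prefix≡1 (λ a → M a b) (λ a → zeroOne a b) (colUnique b)

  rank≤min : ∀ k l → rank M k l ℤ.≤ + (k ⊓ l)
  rank≤min k l with ℕP.⊓-sel k l
  ... | inj₁ e rewrite e = Σ<-count k _ (λ a _ → rowPrefix≤1 a l)
  ... | inj₂ e rewrite e | rank-byColumns M k l = Σ<-count l _ (λ b _ → colPrefix≤1 b k)

record PartialPermIn (n : ℕ) (M : IMat) : Set where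
  field
    supp : Supp n M
    partialPerm : PartialPerm M
  open PartialPerm partialPerm public

PartialPerm-sub : ∀ {M N} → PartialPerm M → (∀ a b → N a b ≡ 0ℤ ⊎ N a b ≡ 1ℤ) →
  (∀ a b → N a b ≡ 1ℤ → M a b ≡ 1ℤ) → PartialPerm N
PartialPerm-sub p zo sub = record
  { zeroOne = zo
  ; rowUnique = λ a b b' e e' → PartialPerm.rowUnique p a b b' (sub a b e) (sub a b' e')
  ; colUnique = λ b a a' e e' → PartialPerm.colUnique p b a a' (sub a b e) (sub a' b e')
  }

removeOne : ∀ {n M} → PartialPermIn n M → ∀ a b → PartialPermIn n (set M a b 0ℤ)
removeOne {n} {M} p a b = record { supp = supp′ ; partialPerm = PartialPerm-sub partialPerm zo sub }
  where
  open PartialPermIn p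
  supp′ : Supp n (set M a b 0ℤ)
  supp′ x y o with set-cases M a b 0ℤ x y
  ... | inj₁ (_ , _ , e) = e
  ... | inj₂ (_ , e) = trans e (supp x y o)
  zo : ∀ x y → set M a b 0ℤ x y ≡ 0ℤ ⊎ set M a b 0ℤ x y ≡ 1ℤ
  zo x y with set-cases M a b 0ℤ x y
  ... | inj₁ (_ , _ , e) = inj₁ e
  ... | inj₂ (_ , e) rewrite e = zeroOne x y
  sub : ∀ x y → set M a b 0ℤ x y ≡ 1ℤ → M x y ≡ 1ℤ
  sub x y e with set-cases M a b 0ℤ x y
  ... | inj₁ (_ , _ , e′) = ⊥-elim (0≢1 (trans (sym e′) e))
  ... | inj₂ (_ , e′) = trans (sym e′) e

addOne : ∀ {n M} → PartialPermIn n M → ∀ i j → i ℕ.< n → j ℕ.< n →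
  (∀ b → M i b ≡ 0ℤ) → (∀ a → M a j ≡ 0ℤ) → PartialPermIn n (set M i j 1ℤ)
addOne {n} {M} p i j i<n j<n rowEmpty colEmpty = record { supp = supp′ ; partialPerm = record
  { zeroOne = zo ; rowUnique = ru ; colUnique = cu } }
  where
  open PartialPermIn p
  M′ = set M i j 1ℤ
  ones : ∀ x y → M′ x y ≡ 1ℤ → (i ≡ x × j ≡ y) ⊎ M x y ≡ 1ℤ
  ones x y e with set-cases M i j 1ℤ x y
  ... | inj₁ (p₁ , p₂ , _) = inj₁ (p₁ , p₂)
  ... | inj₂ (_ , e′) = inj₂ (trans (sym e′) e)
  supp′ : Supp n M′
  supp′ x y o with set-cases M i j 1ℤ x y
  ... | inj₁ (refl , refl , _) = ⊥-elim ([ ℕP.<⇒≱ i<n , ℕP.<⇒≱ j<n ] o)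
  ... | inj₂ (_ , e) = trans e (supp x y o)
  zo : ∀ x y → M′ x y ≡ 0ℤ ⊎ M′ x y ≡ 1ℤ
  zo x y with set-cases M i j 1ℤ x y
  ... | inj₁ (_ , _ , e) = inj₂ e
  ... | inj₂ (_ , e) rewrite e = zeroOne x y
  ru : ∀ x y y' → M′ x y ≡ 1ℤ → M′ x y' ≡ 1ℤ → y ≡ y'
  ru x y y' e e' with ones x y e | ones x y' e'
  ... | inj₁ (refl , refl) | inj₁ (_ , refl) = refl
  ... | inj₁ (refl , refl) | inj₂ q = ⊥-elim (0≢1 (trans (sym (rowEmpty y')) q))
  ... | inj₂ q | inj₁ (refl , refl) = ⊥-elim (0≢1 (trans (sym (rowEmpty y)) q))
  ... | inj₂ q | inj₂ q' = rowUnique x y y' q q'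
  cu : ∀ y x x' → M′ x y ≡ 1ℤ → M′ x' y ≡ 1ℤ → x ≡ x'
  cu y x x' e e' with ones x y e | ones x' y e'
  ... | inj₁ (refl , refl) | inj₁ (refl , _) = refl
  ... | inj₁ (refl , refl) | inj₂ q = ⊥-elim (0≢1 (trans (sym (colEmpty x')) q))
  ... | inj₂ q | inj₁ (refl , refl) = ⊥-elim (0≢1 (trans (sym (colEmpty x)) q))
  ... | inj₂ q | inj₂ q' = colUnique y x x' q q'

removeOne-rowEmpty : ∀ {n M} → PartialPermIn n M → ∀ a b → M a b ≡ 1ℤ → ∀ y → set M a b 0ℤ a y ≡ 0ℤ
removeOne-rowEmpty {M = M} p a b mab y with set-cases M a b 0ℤ a y
... | inj₁ (_ , _ , e) = e
... | inj₂ (inj₁ a≢a , _) = ⊥-elim (a≢a refl)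
... | inj₂ (inj₂ b≢y , e) =
  trans e ([ (λ z → z) , (λ one → ⊥-elim (b≢y (PartialPermIn.rowUnique p a b y mab one))) ]′ (PartialPermIn.zeroOne p a y))

moveOne : ∀ {n M} → PartialPermIn n M → ∀ a b j → a ℕ.< n → j ℕ.< n → M a b ≡ 1ℤ → j ≢ b →
  (∀ x → M x j ≡ 0ℤ) → PartialPermIn n (set (set M a b 0ℤ) a j 1ℤ)
moveOne {M = M} p a b j a<n j<n mab j≢b colEmpty =
  addOne (removeOne p a b) a j a<n j<n (removeOne-rowEmpty p a b mab)
    (λ x → trans (set-miss M a b 0ℤ x j (inj₂ (λ b≡j → j≢b (sym b≡j)))) (colEmpty x))

-- rank M ≤ rank N on [0, n]²; in the order of the paper this says N ≤ M.
RankBelow : ℕ → IMat → IMat → Set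
RankBelow n M N = ∀ k l → k ℕ.≤ n → l ℕ.≤ n → rank M k l ℤ.≤ rank N k l

RankBelow-trans : ∀ {n M N P} → RankBelow n M N → RankBelow n N P → RankBelow n M P
RankBelow-trans h h' k l p q = ℤP.≤-trans (h k l p q) (h' k l p q)

RankBound : ℕ → IMat → Set
RankBound n U = ∀ k l → k ℕ.≤ n → l ℕ.≤ n → + k + + l ℤ.≤ rank U k l + + n

Full : ℕ → IMat → Set
Full n M = ∀ a → a ℕ.< n → ∃ λ b → b ℕ.< n × M a b ≡ 1ℤ

EmptyRow : ℕ → IMat → ℕ → Set
EmptyRow n M a = ∀ b → b ℕ.< n → M a b ≡ 0ℤ

EmptyCol : ℕ → IMat → ℕ → Set
EmptyCol n M b = ∀ a → a ℕ.< n → M a b ≡ 0ℤ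

module Lines {n M} (p : PartialPermIn n M) where
  open PartialPermIn p

  emptyRow? : ∀ a → Dec (EmptyRow n M a)
  emptyRow? a = allBelow? _ (λ b → M a b ℤ.≟ 0ℤ) n

  emptyCol? : ∀ b → Dec (EmptyCol n M b)
  emptyCol? b = allBelow? _ (λ a → M a b ℤ.≟ 0ℤ) n

  rowOne : ∀ a → ¬ EmptyRow n M a → ∃ λ b → b ℕ.< n × M a b ≡ 1ℤ
  rowOne a ne with ℕP.anyUpTo? (λ b → M a b ℤ.≟ 1ℤ) n
  ... | yes w = w
  ... | no nw = ⊥-elim (ne (λ b q → [ (λ z → z) , (λ z → ⊥-elim (nw (b , q , z))) ] (zeroOne a b)))

  colOne : ∀ b → ¬ EmptyCol n M b → ∃ λ a → a ℕ.< n × M a b ≡ 1ℤ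
  colOne b ne with ℕP.anyUpTo? (λ a → M a b ℤ.≟ 1ℤ) n
  ... | yes w = w
  ... | no nw = ⊥-elim (ne (λ a q → [ (λ z → z) , (λ z → ⊥-elim (nw (a , q , z))) ] (zeroOne a b)))

  emptyRow-all : ∀ a → EmptyRow n M a → ∀ b → M a b ≡ 0ℤ
  emptyRow-all a e b with b ℕ.<? n
  ... | yes q = e b q
  ... | no q = supp a b (inj₂ (ℕP.≮⇒≥ q))

  emptyCol-all : ∀ b → EmptyCol n M b → ∀ a → M a b ≡ 0ℤ
  emptyCol-all b e a with a ℕ.<? n
  ... | yes q = e a q
  ... | no q = supp a b (inj₁ (ℕP.≮⇒≥ q))

  rowsFrom : ∀ k → k ℕ.≤ n → (∀ a → k ℕ.≤ a → a ℕ.< n → ∃ λ b → b ℕ.< n × M a b ≡ 1ℤ) →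
    rank M n n ≡ rank M k n + + (n ∸ k)
  rowsFrom k k≤n ones = Σ<-padOnes k n (λ a → Σ< n (M a)) k≤n
    (λ a ka an → let (b , b<n , e) = ones a ka an in rowSum≡1 a n b b<n e)

  colsFrom : ∀ l → l ℕ.≤ n → (∀ b → l ℕ.≤ b → b ℕ.< n → ∃ λ a → a ℕ.< n × M a b ≡ 1ℤ) →
    rank M n n ≡ rank M n l + + (n ∸ l)
  colsFrom l l≤n ones = trans (rank-byColumns M n n)
    (trans (Σ<-padOnes l n (λ b → Σ< n (λ x → M x b)) l≤n
             (λ b lb bn → let (a , a<n , e) = ones b lb bn in colSum≡1 b n a a<n e))
           (cong (_+ + (n ∸ l)) (sym (rank-byColumns M n l))))

  rank-allCols : (∀ b → b ℕ.< n → ¬ EmptyCol n M b) → rank M n n ≡ + n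
  rank-allCols h = trans (colsFrom 0 z≤n (λ b _ q → colOne b (h b q)))
    (trans (cong (_+ + n) (rank-zeroCols M n)) (ℤP.+-identityˡ _))

  rank-emptyRow : ∀ i → i ℕ.< n → EmptyRow n M i → 1ℤ + rank M n n ℤ.≤ + n
  rank-emptyRow i i<n e = Σ<-countStrict n (λ a → Σ< n (M a)) i i<n (Σ<-vanish n _ e)
    (λ a _ → rowPrefix≤1 a n)

solveFor : ∀ {x} y c → x ≡ y + c → y ≡ x - c
solveFor y c refl = sym (lem y c)
  where lem : ∀ y c → y + c - c ≡ y
        lem = solve-∀

-- Inclusion–exclusion for the ones in the corner [k, n) × [l, n): with
-- X = r(n,n), Y = r(k,n), Z = r(n,l), W = r(k,l), P = n - k, Q = n - l.
cornerIdentity : ∀ {X Y Z W N K L P Q : ℤ} → P ≡ N - K → Q ≡ N - L → Y ≡ X - P → Z ≡ X - Q →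
  (X - Z) - (Y - W) ≡ (N - X) + ((W + N) - (K + L))
cornerIdentity {X} {W = W} {N} {K} {L} refl refl refl refl = lem X W N K L
  where lem : ∀ X W N K L → (X - (X - (N - L))) - ((X - (N - K)) - W) ≡ (N - X) + ((W + N) - (K + L))
        lem = solve-∀

cornerHasOne : ∀ {n M} → PartialPermIn n M → ∀ k l → k ℕ.≤ n → l ℕ.≤ n →
  (∀ a → k ℕ.≤ a → a ℕ.< n → ∃ λ b → b ℕ.< n × M a b ≡ 1ℤ) →
  (∀ b → l ℕ.≤ b → b ℕ.< n → ∃ λ a → a ℕ.< n × M a b ≡ 1ℤ) →
  1ℤ + rank M n n ℤ.≤ + n → + k + + l ℤ.≤ rank M k l + + n →
  ∃ λ a → ∃ λ b → k ℕ.≤ a × a ℕ.< n × l ℕ.≤ b × M a b ≡ 1ℤ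
cornerHasOne {n} {M} p k l k≤n l≤n rows cols deficient bound = a , b , ka , an , lb , mab
  where
  open PartialPermIn p
  open Lines p
  nk : + n ≡ + (n ∸ k) + + k
  nk = trans (cong +_ (sym (ℕP.m∸n+n≡m k≤n))) (ℤP.pos-+ (n ∸ k) k)
  nl : + n ≡ + (n ∸ l) + + l
  nl = trans (cong +_ (sym (ℕP.m∸n+n≡m l≤n))) (ℤP.pos-+ (n ∸ l) l)
  count : 1ℤ ℤ.≤ (rank M n n - rank M n l) - (rank M k n - rank M k l)
  count = subst₂ ℤ._≤_ (ℤP.+-identityʳ 1ℤ)
    (sym (cornerIdentity {rank M n n} {rank M k n} {rank M n l} {rank M k l} {+ n} {+ k} {+ l}
      (solveFor (+ (n ∸ k)) (+ k) nk) (solveFor (+ (n ∸ l)) (+ l) nl)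
      (solveFor (rank M k n) (+ (n ∸ k)) (rowsFrom k k≤n rows))
      (solveFor (rank M n l) (+ (n ∸ l)) (colsFrom l l≤n cols))))
    (ℤP.+-mono-≤ (subst₂ ℤ._≤_ (lem 1ℤ (rank M n n)) refl (ℤP.+-monoˡ-≤ (- rank M n n) deficient))
                 (ℤP.i≤j⇒0≤j-i bound))
    where lem : ∀ x y → x + y - y ≡ x
          lem = solve-∀
  g : ℕ → ℤ
  g a = Σ< n (M a) - Σ< l (M a)
  Σg : ∀ m → Σ< m g ≡ rank M m n - rank M m l
  Σg m = Σ<-diff m (λ a → Σ< n (M a)) (λ a → Σ< l (M a))
  someRow : ∃ λ a → k ℕ.≤ a × a ℕ.< n × g a ≢ 0ℤ
  someRow = Σ<-nonzero k n g k≤n λ e → ¬1≤0 (subst₂ ℤ._≤_ refl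
    (trans (cong₂ _-_ (sym (Σg n)) (sym (Σg k))) (trans (cong (_- Σ< k g) e) (ℤP.+-inverseʳ (Σ< k g)))) count)
  a : ℕ
  a = proj₁ someRow
  ka : k ℕ.≤ a
  ka = proj₁ (proj₂ someRow)
  an : a ℕ.< n
  an = proj₁ (proj₂ (proj₂ someRow))
  someCol : ∃ λ b → l ℕ.≤ b × b ℕ.< n × M a b ≢ 0ℤ
  someCol = Σ<-nonzero l n (M a) l≤n λ e →
    proj₂ (proj₂ (proj₂ someRow)) (trans (cong (_- Σ< l (M a)) e) (ℤP.+-inverseʳ (Σ< l (M a))))
  b : ℕ
  b = proj₁ someCol
  lb : l ℕ.≤ b
  lb = proj₁ (proj₂ someCol)
  mab : M a b ≡ 1ℤ
  mab = [ (λ z → ⊥-elim (proj₂ (proj₂ (proj₂ someCol)) z)) , (λ z → z) ]′ (zeroOne a b)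

Improves : ℕ → IMat → IMat → IMat → Set
Improves n U M M′ = PartialPermIn n M′ × RankBelow n M′ U × RankBelow n M M′ ×
  (∃ λ k → ∃ λ l → k ℕ.≤ n × l ℕ.≤ n × 1ℤ + rank M k l ℤ.≤ rank M′ k l)

improvesOn : ∀ {n U M M′} → PartialPermIn n M′ → RankBelow n M U →
  (C : ℕ → ℕ → Set) → (∀ k l → Dec (C k l)) →
  (∀ k l → C k l → rank M′ k l ≡ 1ℤ + rank M k l) → (∀ k l → ¬ C k l → rank M′ k l ≡ rank M k l) →
  (∀ k l → k ℕ.≤ n → l ℕ.≤ n → C k l → rank M k l ≢ rank U k l) →
  (∃ λ k → ∃ λ l → k ℕ.≤ n × l ℕ.≤ n × C k l) → Improves n U M M′
improvesOn {n} {U} {M} {M′} p′ below C C? rise flat slack (k₀ , l₀ , k₀≤n , l₀≤n , c₀) =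
  p′ , below′ , above , (k₀ , l₀ , k₀≤n , l₀≤n , ℤP.≤-reflexive (sym (rise k₀ l₀ c₀)))
  where
  below′ : RankBelow n M′ U
  below′ k l p q with C? k l
  ... | yes c rewrite rise k l c = ≤∧≢⇒1+≤ (below k l p q) (slack k l p q c)
  ... | no c rewrite flat k l c = below k l p q
  above : RankBelow n M M′
  above k l p q with C? k l
  ... | yes c rewrite rise k l c = ℤP.i≤j⇒i≤1+j ℤP.≤-refl
  ... | no c rewrite flat k l c = ℤP.≤-refl

-- Let i be the last empty row and j the last empty
-- column of M.  If M is nowhere tight against U on {k > i, l > j}, put a one at
-- (i, j).  Otherwise take the last row k > i with a tight (k, l), l > j; the
-- corner [k, n) × [l, n) then holds a one (a, b), which is moved to (a, j).
module Improvement (n : ℕ) (U : IMat) (bound : RankBound n U)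
                   (M : IMat) (p : PartialPermIn n M) (below : RankBelow n M U) where
  open PartialPermIn p
  open Lines p

  Tight : ℕ → ℕ → ℕ → Set
  Tight i j k = i ℕ.< k × ∃ λ l → l ℕ.< suc n × j ℕ.< l × rank M k l ≡ rank U k l

  tight? : ∀ i j k → Dec (Tight i j k)
  tight? i j k = (i ℕ.<? k) ×-dec ℕP.anyUpTo? (λ l → (j ℕ.<? l) ×-dec (rank M k l ℤ.≟ rank U k l)) (suc n)

  viaAdd : ∀ i j → i ℕ.< n → j ℕ.< n → EmptyRow n M i → EmptyCol n M j →
    (∀ k → k ℕ.< suc n → ¬ Tight i j k) → ∃ λ M′ → Improves n U M M′
  viaAdd i j i<n j<n ei ej none = M′ ,
    improvesOn (addOne p i j i<n j<n (emptyRow-all i ei) (emptyCol-all j ej)) below C C? rise flat slack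
      (suc i , suc j , i<n , j<n , ℕP.≤-refl , ℕP.≤-refl)
    where
    M′ = set M i j 1ℤ
    C : ℕ → ℕ → Set
    C k l = i ℕ.< k × j ℕ.< l
    C? : ∀ k l → Dec (C k l)
    C? k l = (i ℕ.<? k) ×-dec (j ℕ.<? l)
    rise : ∀ k l → C k l → rank M′ k l ≡ 1ℤ + rank M k l
    rise k l (ik , jl) = trans (rank-set-in M i j 1ℤ k l ik jl)
      (trans (cong (λ z → rank M k l + (1ℤ - z)) (ei j j<n)) (ℤP.+-comm (rank M k l) 1ℤ))
    flat : ∀ k l → ¬ C k l → rank M′ k l ≡ rank M k l
    flat k l nc with i ℕ.<? k
    ... | yes ik = rank-set-out M i j 1ℤ k l (inj₂ (ℕP.≮⇒≥ (λ jl → nc (ik , jl))))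
    ... | no nik = rank-set-out M i j 1ℤ k l (inj₁ (ℕP.≮⇒≥ nik))
    slack : ∀ k l → k ℕ.≤ n → l ℕ.≤ n → C k l → rank M k l ≢ rank U k l
    slack k l kn ln (ik , jl) t = none k (s≤s kn) (ik , l , s≤s ln , jl , t)

  viaMove : ∀ a b j → a ℕ.< n → j ℕ.< n → j ℕ.< b → M a b ≡ 1ℤ → EmptyCol n M j →
    (∀ k l → a ℕ.< k → k ℕ.≤ n → l ℕ.≤ n → j ℕ.< l → rank M k l ≢ rank U k l) →
    ∃ λ M′ → Improves n U M M′
  viaMove a b j a<n j<n j<b mab ej slack = M′ ,
    improvesOn (moveOne p a b j a<n j<n mab (λ e → ℕP.<-irrefl e j<b) (emptyCol-all j ej)) below C C? rise flat
      (λ k l kn ln (ak , jl , _) → slack k l ak kn ln jl)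
      (suc a , suc j , a<n , j<n , ℕP.≤-refl , ℕP.≤-refl , j<b)
    where
    M₁ = set M a b 0ℤ
    M′ = set M₁ a j 1ℤ
    m₁aj : M₁ a j ≡ 0ℤ
    m₁aj = trans (set-miss M a b 0ℤ a j (inj₂ (λ e → ℕP.<-irrefl (sym e) j<b))) (ej a a<n)
    C : ℕ → ℕ → Set
    C k l = a ℕ.< k × j ℕ.< l × l ℕ.≤ b
    C? : ∀ k l → Dec (C k l)
    C? k l = (a ℕ.<? k) ×-dec ((j ℕ.<? l) ×-dec (l ℕ.≤? b))
    rise : ∀ k l → C k l → rank M′ k l ≡ 1ℤ + rank M k l
    rise k l (ak , jl , lb) = trans (rank-set-in M₁ a j 1ℤ k l ak jl)
      (trans (cong₂ (λ x y → x + (1ℤ - y)) (rank-set-out M a b 0ℤ k l (inj₂ lb)) m₁aj)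
             (ℤP.+-comm (rank M k l) 1ℤ))
    flat : ∀ k l → ¬ C k l → rank M′ k l ≡ rank M k l
    flat k l nc with a ℕ.<? k | j ℕ.<? l
    ... | no nak | _ = trans (rank-set-out M₁ a j 1ℤ k l (inj₁ (ℕP.≮⇒≥ nak)))
                             (rank-set-out M a b 0ℤ k l (inj₁ (ℕP.≮⇒≥ nak)))
    ... | yes ak | no njl = trans (rank-set-out M₁ a j 1ℤ k l (inj₂ (ℕP.≮⇒≥ njl)))
                                  (rank-set-out M a b 0ℤ k l (inj₂ (ℕP.≤-trans (ℕP.≮⇒≥ njl) (ℕP.<⇒≤ j<b))))
    ... | yes ak | yes jl = begin
      rank M′ k l                               ≡⟨ rank-set-in M₁ a j 1ℤ k l ak jl ⟩
      rank M₁ k l + (1ℤ - M₁ a j)               ≡⟨ cong₂ (λ x y → x + (1ℤ - y)) (rank-set-in M a b 0ℤ k l ak bl) m₁aj ⟩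
      rank M k l + (0ℤ - M a b) + (1ℤ - 0ℤ)     ≡⟨ cong (λ z → rank M k l + (0ℤ - z) + 1ℤ) mab ⟩
      rank M k l + (0ℤ - 1ℤ) + 1ℤ               ≡⟨ lem (rank M k l) ⟩
      rank M k l                                ∎
      where
      open ≡-Reasoning
      bl : b ℕ.< l
      bl = ℕP.≰⇒> (λ lb → nc (ak , jl , lb))
      lem : ∀ x → x + (0ℤ - 1ℤ) + 1ℤ ≡ x
      lem = solve-∀

  -- an empty row forces an empty column, since M then has fewer than n ones
  improve : ∀ i₀ → i₀ ℕ.< n → EmptyRow n M i₀ → ∃ λ M′ → Improves n U M M′
  improve i₀ i₀<n e₀ with lastBelow (EmptyRow n M) emptyRow? n
  ... | inj₂ none = ⊥-elim (none i₀ i₀<n e₀)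
  ... | inj₁ (i , i<n , ei , laterRows) with lastBelow (EmptyCol n M) emptyCol? n
  ...   | inj₂ none = ⊥-elim (ℕP.<-irrefl refl (ℤP.drop‿+≤+
          (subst₂ ℤ._≤_ (trans (cong (_+_ 1ℤ) (rank-allCols none)) (sym (ℤP.pos-+ 1 n))) refl (rank-emptyRow i i<n ei))))
  ...   | inj₁ (j , j<n , ej , laterCols) with lastBelow (Tight i j) (tight? i j) (suc n)
  ...     | inj₂ none = viaAdd i j i<n j<n ei ej none
  ...     | inj₁ (k , k<sn , (i<k , l , l<sn , j<l , tight) , laterTight) =
    let (a , b , ka , a<n , lb , mab) = cornerHasOne p k l k≤n l≤n
          (λ a ka an → rowOne a (laterRows a (ℕP.<-≤-trans i<k ka) an))
          (λ b lb bn → colOne b (laterCols b (ℕP.<-≤-trans j<l lb) bn))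
          (rank-emptyRow i i<n ei)
          (subst₂ ℤ._≤_ refl (cong (_+ + n) (sym tight)) (bound k l k≤n l≤n))
    in viaMove a b j a<n j<n (ℕP.<-≤-trans j<l lb) mab ej
         (λ k′ l′ ak′ k′n l′n jl′ t → laterTight k′ (ℕP.≤-<-trans ka ak′) (s≤s k′n)
            (ℕP.<-trans i<k (ℕP.≤-<-trans ka ak′) , l′ , s≤s l′n , jl′ , t))
    where
    k≤n : k ℕ.≤ n
    k≤n = ℕP.≤-pred k<sn
    l≤n : l ℕ.≤ n
    l≤n = ℕP.≤-pred l<sn

-- Iterating the improvement step.  The deficit Σ_{k, l ≤ n} (rank U − rank M)
-- is a nonnegative integer that drops with every step, so after finitely many
-- steps no row of M is empty.
module Filling (n : ℕ) (U : IMat) (bound : RankBound n U) where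

  deficit : IMat → ℤ
  deficit M = Σ< (suc n) (λ k → Σ< (suc n) (λ l → rank U k l - rank M k l))

  deficit≥0 : ∀ M → RankBelow n M U → 0ℤ ℤ.≤ deficit M
  deficit≥0 M below = subst₂ ℤ._≤_ (Σ<-zero (suc n)) refl (Σ<-mono (suc n) λ k kp →
    subst₂ ℤ._≤_ (Σ<-zero (suc n)) refl (Σ<-mono (suc n) λ l lp →
      ℤP.i≤j⇒0≤j-i (below k l (ℕP.≤-pred kp) (ℕP.≤-pred lp))))

  deficit-drops : ∀ M M′ → Improves n U M M′ → 1ℤ + deficit M′ ℤ.≤ deficit M
  deficit-drops M M′ (_ , _ , above , (k₀ , l₀ , k₀≤n , l₀≤n , up)) =
    Σ<-strict (suc n) _ _ k₀ (s≤s k₀≤n)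
      (λ k kp → Σ<-mono (suc n) (λ l lp → ℤP.+-monoʳ-≤ (rank U k l) (ℤP.neg-mono-≤ (above k l (ℕP.≤-pred kp) (ℕP.≤-pred lp)))))
      (Σ<-strict (suc n) _ _ l₀ (s≤s l₀≤n)
        (λ l lp → ℤP.+-monoʳ-≤ (rank U k₀ l) (ℤP.neg-mono-≤ (above k₀ l k₀≤n (ℕP.≤-pred lp))))
        (subst₂ ℤ._≤_ (lem₁ (rank U k₀ l₀) (rank M′ k₀ l₀)) (lem₂ (rank U k₀ l₀) (rank M k₀ l₀))
          (ℤP.+-monoʳ-≤ (1ℤ + rank U k₀ l₀) (ℤP.neg-mono-≤ up))))
    where
    lem₁ : ∀ u b → 1ℤ + u + - b ≡ 1ℤ + (u - b)
    lem₁ = solve-∀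
    lem₂ : ∀ u a → 1ℤ + u + - (1ℤ + a) ≡ u - a
    lem₂ = solve-∀

  Filled : IMat → Set
  Filled M = ∃ λ M* → PartialPermIn n M* × Full n M* × RankBelow n M* U × RankBelow n M M*

  rowHasOne? : ∀ (M : IMat) a → Dec (∃ λ b → b ℕ.< n × M a b ≡ 1ℤ)
  rowHasOne? M a = ℕP.anyUpTo? (λ b → M a b ℤ.≟ 1ℤ) n

  fillWithin : ∀ fuel M → PartialPermIn n M → RankBelow n M U → deficit M ℤ.≤ + fuel → Filled M
  fillWithin fuel M p below enough
    with ℕP.anyUpTo? (λ a → ¬? (rowHasOne? M a)) n
  ... | no noEmptyRow = M , p , (λ a an → decidable-stable (rowHasOne? M a) (λ noOne → noEmptyRow (a , an , noOne))) ,
                        below , (λ k l _ _ → ℤP.≤-refl)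
  ... | yes (a , a<n , noOne) = continue fuel enough (Improvement.improve n U bound M p below a a<n emptyA)
    where
    emptyA : EmptyRow n M a
    emptyA b b<n = [ (λ z → z) , (λ z → ⊥-elim (noOne (b , b<n , z))) ]′ (PartialPermIn.zeroOne p a b)
    continue : ∀ fuel → deficit M ℤ.≤ + fuel → (∃ λ M′ → Improves n U M M′) → Filled M
    continue zero enough (M′ , imp) = ⊥-elim (¬1≤0 (ℤP.≤-trans (ℤP.≤-trans
      (subst₂ ℤ._≤_ (ℤP.+-identityʳ 1ℤ) refl (ℤP.+-monoʳ-≤ 1ℤ (deficit≥0 M′ (proj₁ (proj₂ imp)))))
      (deficit-drops M M′ imp)) enough))
    continue (suc fuel) enough (M′ , imp@(p′ , below′ , above , _))
      with fillWithin fuel M′ p′ below′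
             (+-cancelˡ-≤ 1ℤ (ℤP.≤-trans (deficit-drops M M′ imp) (subst₂ ℤ._≤_ refl (ℤP.pos-+ 1 fuel) enough)))
    ... | M* , p* , full* , below* , above* = M* , p* , full* , below* , RankBelow-trans above above*

  fill : ∀ M → PartialPermIn n M → RankBelow n M U → Filled M
  fill M p below = fillWithin ℤ.∣ deficit M ∣ M p below (ℤP.≤-reflexive (sym (ℤP.0≤i⇒+∣i∣≡i (deficit≥0 M below))))

Alternating : (ℕ → ℤ) → Set
Alternating f = ∀ a a' → a ℕ.< a' → f a ≢ 0ℤ → f a' ≢ 0ℤ → (∀ x → a ℕ.< x → x ℕ.< a' → f x ≡ 0ℤ) → f a' ≡ - f a

module AlternatingSums (f : ℕ → ℤ) (alt : Alternating f) where

  LastNonzero : ℕ → ℕ → Set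
  LastNonzero k m = m ℕ.< k × f m ≢ 0ℤ × (∀ x → m ℕ.< x → x ℕ.< k → f x ≡ 0ℤ)

  prefix : ∀ k → Σ< k f ≡ 0ℤ ⊎ (∃ λ m → LastNonzero k m × Σ< k f ≡ f m)
  prefix zero = inj₁ refl
  prefix (suc k) with f k ℤ.≟ 0ℤ | prefix k
  ... | yes fk | inj₁ s = inj₁ (trans (cong₂ _+_ s fk) refl)
  ... | yes fk | inj₂ (m , (m<k , fm , gap) , s) =
    inj₂ (m , (ℕP.m<n⇒m<1+n m<k , fm , gap′) , trans (cong₂ _+_ s fk) (ℤP.+-identityʳ (f m)))
    where gap′ : ∀ x → m ℕ.< x → x ℕ.< suc k → f x ≡ 0ℤ
          gap′ x p q with x ℕ.≟ k
          ... | yes refl = fk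
          ... | no x≢k = gap x p (ℕP.≤∧≢⇒< (ℕP.≤-pred q) x≢k)
  ... | no fk | inj₁ s = inj₂ (k , (ℕP.≤-refl , fk , λ x p q → ⊥-elim (ℕP.<⇒≱ p (ℕP.≤-pred q))) ,
    trans (cong (_+ f k) s) (ℤP.+-identityˡ (f k)))
  ... | no fk | inj₂ (m , (m<k , fm , gap) , s) = inj₁ (begin
    Σ< k f + f k   ≡⟨ cong₂ _+_ s (alt m k m<k fm fk gap) ⟩
    f m + - f m    ≡⟨ ℤP.+-inverseʳ (f m) ⟩
    0ℤ             ∎)
    where open ≡-Reasoning

  prefix≤1 : (∀ a → f a ℤ.≤ 1ℤ) → ∀ k → Σ< k f ℤ.≤ 1ℤ
  prefix≤1 ≤1 k = [ (λ s → subst₂ ℤ._≤_ (sym s) refl (ℤ.+≤+ z≤n)) ,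
                    (λ (m , _ , s) → subst₂ ℤ._≤_ (sym s) refl (≤1 m)) ]′ (prefix k)

record ASMIn (n : ℕ) (U : IMat) : Set where
  field
    supp : Supp n U
    entry≤1 : ∀ a b → U a b ℤ.≤ 1ℤ
    rowSum : ∀ a → a ℕ.< n → Σ< n (U a) ≡ 1ℤ
    colAlternating : ∀ b → Alternating (λ a → U a b)

  -- Column prefix sums are ≤ 1, so r_U(k, n) = k ≤ r_U(k, l) + (n - l).
  rankBound : RankBound n U
  rankBound k l k≤n l≤n = subst₂ ℤ._≤_ refl
      (trans (ℤP.+-assoc (rank U k l) _ _) (cong (_+_ (rank U k l)) (trans (sym (ℤP.pos-+ (n ∸ l) l)) (cong +_ (ℕP.m∸n+n≡m l≤n)))))
      (ℤP.+-monoˡ-≤ (+ l) k≤)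
    where
    rank-kn : rank U k n ≡ + k
    rank-kn = trans (Σ<-padOnes 0 k (λ a → Σ< n (U a)) z≤n (λ a _ p → rowSum a (ℕP.<-≤-trans p k≤n)))
                    (ℤP.+-identityˡ _)
    k≤ : + k ℤ.≤ rank U k l + + (n ∸ l)
    k≤ = subst₂ ℤ._≤_ (trans (sym (rank-byColumns U k n)) rank-kn) (cong (_+ + (n ∸ l)) (sym (rank-byColumns U k l)))
      (Σ<-countFrom l n (λ b → Σ< k (λ a → U a b)) l≤n
        (λ b _ _ → AlternatingSums.prefix≤1 (λ a → U a b) (colAlternating b) (λ a → entry≤1 a b) k))

-- Reading a Fin-indexed vector at a natural number, with default 0.
at : ∀ {n} → (Fin n → ℤ) → ℕ → ℤ
at {zero} f a = 0ℤ
at {suc n} f zero = f zero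
at {suc n} f (suc a) = at (f ∘ suc) a

at-toℕ : ∀ {n} (f : Fin n → ℤ) i → at f (toℕ i) ≡ f i
at-toℕ {suc n} f zero = refl
at-toℕ {suc n} f (suc i) = at-toℕ (f ∘ suc) i

at-fromℕ< : ∀ {n} (f : Fin n → ℤ) a (p : a ℕ.< n) → at f a ≡ f (fromℕ< p)
at-fromℕ< f a p = trans (cong (at f) (sym (FP.toℕ-fromℕ< p))) (at-toℕ f (fromℕ< p))

at-out : ∀ {n} (f : Fin n → ℤ) a → n ℕ.≤ a → at f a ≡ 0ℤ
at-out {zero} f a _ = refl
at-out {suc n} f (suc a) (s≤s p) = at-out (f ∘ suc) a p

pad : ∀ {n} → Mat n → IMat
pad X a b = at (λ i → at (X i) b) a

pad-toℕ : ∀ {n} (X : Mat n) i j → pad X (toℕ i) (toℕ j) ≡ X i j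
pad-toℕ X i j = trans (at-toℕ (λ i → at (X i) (toℕ j)) i) (at-toℕ (X i) j)

pad-fromℕ< : ∀ {n} (X : Mat n) a b (p : a ℕ.< n) (q : b ℕ.< n) → pad X a b ≡ X (fromℕ< p) (fromℕ< q)
pad-fromℕ< X a b p q = trans (at-fromℕ< (λ i → at (X i) b) a p) (at-fromℕ< (X (fromℕ< p)) b q)

pad-supp : ∀ {n} (X : Mat n) → Supp n (pad X)
pad-supp X a b (inj₁ p) = at-out (λ i → at (X i) b) a p
pad-supp {n} X a b (inj₂ q) with a ℕ.<? n
... | yes p = trans (at-fromℕ< _ a p) (at-out (X (fromℕ< p)) b q)
... | no p = at-out _ a (ℕP.≮⇒≥ p)

inRange? : ∀ n a b → (a ℕ.< n × b ℕ.< n) ⊎ (n ℕ.≤ a ⊎ n ℕ.≤ b)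
inRange? n a b with a ℕ.<? n | b ℕ.<? n
... | yes p | yes q = inj₁ (p , q)
... | no p | _ = inj₂ (inj₁ (ℕP.≮⇒≥ p))
... | yes _ | no q = inj₂ (inj₂ (ℕP.≮⇒≥ q))

pad-nonzero : ∀ {n} (X : Mat n) a b → pad X a b ≢ 0ℤ → a ℕ.< n × b ℕ.< n
pad-nonzero {n} X a b ne with inRange? n a b
... | inj₁ pq = pq
... | inj₂ o = ⊥-elim (ne (pad-supp X a b o))

pad-cong : ∀ {n} (X Y : Mat n) → X ≡M Y → ∀ a b → pad X a b ≡ pad Y a b
pad-cong {n} X Y h a b with inRange? n a b
... | inj₁ (p , q) = trans (pad-fromℕ< X a b p q) (trans (h _ _) (sym (pad-fromℕ< Y a b p q)))
... | inj₂ o = trans (pad-supp X a b o) (sym (pad-supp Y a b o))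

pad-injective : ∀ {n} (X Y : Mat n) → (∀ a b → pad X a b ≡ pad Y a b) → X ≡M Y
pad-injective X Y h i j = trans (sym (pad-toℕ X i j)) (trans (h (toℕ i) (toℕ j)) (pad-toℕ Y i j))

sumFin-Σ< : ∀ n (φ : Fin n → ℤ) (ψ : ℕ → ℤ) → (∀ a (p : a ℕ.< n) → ψ a ≡ φ (fromℕ< p)) → sumFin φ ≡ Σ< n ψ
sumFin-Σ< zero φ ψ h = refl
sumFin-Σ< (suc n) φ ψ h = trans (cong₂ _+_ (sym (h 0 (s≤s z≤n))) (sumFin-Σ< n (φ ∘ suc) (ψ ∘ suc) (λ a p → h (suc a) (s≤s p))))
                                (sym (Σ<-shift n ψ))

Σ<-upTo : ∀ m t (g : ℕ → ℤ) → (∀ a → m ℕ.≤ a → g a ≡ 0ℤ) → Σ< m (λ a → if ⌊ a ℕ.≤? t ⌋ then g a else 0ℤ) ≡ Σ< (suc t) g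
Σ<-upTo m t g hg = trans (sym (Σ<-padZeros m N h (ℕP.m≤m⊔n m (suc t)) (λ a p _ → beyondSupp a p)))
                         (trans (Σ<-padZeros (suc t) N h (ℕP.m≤n⊔m m (suc t)) (λ a p _ → beyondT a p)) (Σ<-cong (suc t) uptoT))
  where
  N = m ⊔ suc t
  h : ℕ → ℤ
  h a = if ⌊ a ℕ.≤? t ⌋ then g a else 0ℤ
  beyondSupp : ∀ a → m ℕ.≤ a → h a ≡ 0ℤ
  beyondSupp a p with a ℕ.≤? t
  ... | yes _ = hg a p
  ... | no _ = refl
  beyondT : ∀ a → suc t ℕ.≤ a → h a ≡ 0ℤ
  beyondT a p with a ℕ.≤? t
  ... | yes q = ⊥-elim (ℕP.<⇒≱ p q)
  ... | no _ = refl
  uptoT : ∀ a → a ℕ.< suc t → h a ≡ g a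
  uptoT a p with a ℕ.≤? t
  ... | yes _ = refl
  ... | no q = ⊥-elim (q (ℕP.≤-pred p))

rk-rank : ∀ {n} (X : Mat n) i j → rk X i j ≡ rank (pad X) (suc (toℕ i)) (suc (toℕ j))
rk-rank {n} X i j = trans (sumFin-Σ< n _ ψ outer)
  (trans (Σ<-cong n (λ a _ → inner a))
         (Σ<-upTo n (toℕ i) _ (λ a p → Σ<-vanish (suc (toℕ j)) _ (λ b _ → pad-supp X a b (inj₁ p)))))
  where
  G : ℕ → ℕ → ℤ
  G a b = if ⌊ a ℕ.≤? toℕ i ⌋ then (if ⌊ b ℕ.≤? toℕ j ⌋ then pad X a b else 0ℤ) else 0ℤ
  ψ : ℕ → ℤ
  ψ a = Σ< n (G a)
  outer : ∀ a (p : a ℕ.< n) → ψ a ≡ sumFin (λ l → if ⌊ toℕ (fromℕ< p) ℕ.≤? toℕ i ⌋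
                                                    then (if ⌊ toℕ l ℕ.≤? toℕ j ⌋ then X (fromℕ< p) l else 0ℤ) else 0ℤ)
  outer a p = sym (sumFin-Σ< n _ (G a) entry)
    where
    entry : ∀ b (q : b ℕ.< n) → G a b ≡ (if ⌊ toℕ (fromℕ< p) ℕ.≤? toℕ i ⌋
                                         then (if ⌊ toℕ (fromℕ< q) ℕ.≤? toℕ j ⌋ then X (fromℕ< p) (fromℕ< q) else 0ℤ) else 0ℤ)
    entry b q rewrite FP.toℕ-fromℕ< p | FP.toℕ-fromℕ< q | pad-fromℕ< X a b p q = refl
  inner : ∀ a → ψ a ≡ (if ⌊ a ℕ.≤? toℕ i ⌋ then Σ< (suc (toℕ j)) (pad X a) else 0ℤ)
  inner a with a ℕ.≤? toℕ i
  ... | yes _ = Σ<-upTo n (toℕ j) (pad X a) (λ b p → pad-supp X a b (inj₂ p))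
  ... | no _ = Σ<-zero n

_≤ᵣ_ : IMat → IMat → Set
M ≤ᵣ N = ∀ k l → rank N k l ℤ.≤ rank M k l

≤ᵣ-fromBox : ∀ n M N → Supp n M → Supp n N → RankBelow n N M → M ≤ᵣ N
≤ᵣ-fromBox n M N sM sN h k l = subst₂ ℤ._≤_ (sym (rank-truncate n N k l sN)) (sym (rank-truncate n M k l sM))
  (h _ _ (ℕP.m⊓n≤n k n) (ℕP.m⊓n≤n l n))

-- The order ≤M of Defs is ≤ᵣ on paddings (r_X(i, j) = rank (pad X) (1+i) (1+j);
-- the ranks at k = 0 or l = 0 vanish).
≤M⇒≤ᵣ : ∀ {n} (X Y : Mat n) → X ≤M Y → pad X ≤ᵣ pad Y
≤M⇒≤ᵣ {n} X Y h = ≤ᵣ-fromBox n _ _ (pad-supp X) (pad-supp Y) box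
  where
  box : RankBelow n (pad Y) (pad X)
  box zero l _ _ = ℤP.≤-refl
  box (suc k) zero _ _ = ℤP.≤-reflexive (trans (rank-zeroCols (pad Y) (suc k)) (sym (rank-zeroCols (pad X) (suc k))))
  box (suc k) (suc l) kp lp = subst₂ (λ x y → rank (pad Y) (suc x) (suc y) ℤ.≤ rank (pad X) (suc x) (suc y))
    (FP.toℕ-fromℕ< kp) (FP.toℕ-fromℕ< lp)
    (subst₂ ℤ._≤_ (rk-rank Y (fromℕ< kp) (fromℕ< lp)) (rk-rank X (fromℕ< kp) (fromℕ< lp)) (h (fromℕ< kp) (fromℕ< lp)))

≤ᵣ⇒≤M : ∀ {n} (X Y : Mat n) → pad X ≤ᵣ pad Y → X ≤M Y
≤ᵣ⇒≤M X Y h i j = subst₂ ℤ._≤_ (sym (rk-rank Y i j)) (sym (rk-rank X i j)) (h (suc (toℕ i)) (suc (toℕ j)))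

≤M-trans : ∀ {n} {X Y Z : Mat n} → X ≤M Y → Y ≤M Z → X ≤M Z
≤M-trans h h' i j = ℤP.≤-trans (h' i j) (h i j)

≡M⇒≤M : ∀ {n} (X Y : Mat n) → X ≡M Y → X ≤M Y
≡M⇒≤M X Y e i j = ℤP.≤-reflexive (sym (trans (rk-rank X i j)
  (trans (rank-cong _ _ (pad-cong X Y e) (suc (toℕ i)) (suc (toℕ j))) (sym (rk-rank Y i j)))))

-- ≤M is antisymmetric, since a matrix is determined by its rank function.
≤M-antisym : ∀ {n} (X Y : Mat n) → X ≤M Y → Y ≤M X → X ≡M Y
≤M-antisym X Y h h' = pad-injective X Y
  (rank-injective _ _ (λ k l → ℤP.≤-antisym (≤M⇒≤ᵣ Y X h' k l) (≤M⇒≤ᵣ X Y h k l)))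

IsPartialPerm-resp : ∀ {n} (X Y : Mat n) → X ≡M Y → IsPartialPerm X → IsPartialPerm Y
IsPartialPerm-resp X Y e (zo , ru , cu) =
  (λ i j → subst (λ v → v ≡ 0ℤ ⊎ v ≡ 1ℤ) (e i j) (zo i j)) ,
  (λ i j j' p q → ru i j j' (trans (e i j) p) (trans (e i j') q)) ,
  (λ j i i' p q → cu j i i' (trans (e i j) p) (trans (e i' j) q))

pad-partialPerm : ∀ {n} (X : Mat n) → IsPartialPerm X → PartialPermIn n (pad X)
pad-partialPerm {n} X (zo , ru , cu) = record { supp = pad-supp X ; partialPerm = record
  { zeroOne = zo′ ; rowUnique = ru′ ; colUnique = cu′ } }
  where
  one : ∀ a b → pad X a b ≡ 1ℤ → Σ (a ℕ.< n) λ p → Σ (b ℕ.< n) λ q → X (fromℕ< p) (fromℕ< q) ≡ 1ℤ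
  one a b e with inRange? n a b
  ... | inj₁ (p , q) = p , q , trans (sym (pad-fromℕ< X a b p q)) e
  ... | inj₂ o = ⊥-elim (0≢1 (trans (sym (pad-supp X a b o)) e))
  zo′ : ∀ a b → pad X a b ≡ 0ℤ ⊎ pad X a b ≡ 1ℤ
  zo′ a b with inRange? n a b
  ... | inj₁ (p , q) rewrite pad-fromℕ< X a b p q = zo _ _
  ... | inj₂ o = inj₁ (pad-supp X a b o)
  ru′ : ∀ a b b' → pad X a b ≡ 1ℤ → pad X a b' ≡ 1ℤ → b ≡ b'
  ru′ a b b' e e' with one a b e | one a b' e'
  ... | p , q , o | p′ , q′ , o′ rewrite FP.fromℕ<-cong a a refl p p′ =
    trans (sym (FP.toℕ-fromℕ< q)) (trans (cong toℕ (ru _ _ _ o o′)) (FP.toℕ-fromℕ< q′))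
  cu′ : ∀ b a a' → pad X a b ≡ 1ℤ → pad X a' b ≡ 1ℤ → a ≡ a'
  cu′ b a a' e e' with one a b e | one a' b e'
  ... | p , q , o | p′ , q′ , o′ rewrite FP.fromℕ<-cong b b refl q q′ =
    trans (sym (FP.toℕ-fromℕ< p)) (trans (cong toℕ (cu _ _ _ o o′)) (FP.toℕ-fromℕ< p′))

pad-ASM : ∀ {n} (A : Mat n) → IsASM A → ASMIn n (pad A)
pad-ASM {n} A (entries , rowSums , _ , _ , colAlt) = record
  { supp = pad-supp A ; entry≤1 = entry≤1 ; rowSum = rowSum ; colAlternating = alternating }
  where
  entry≤1 : ∀ a b → pad A a b ℤ.≤ 1ℤ
  entry≤1 a b with inRange? n a b
  ... | inj₂ o rewrite pad-supp A a b o = ℤ.+≤+ z≤n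
  ... | inj₁ (p , q) rewrite pad-fromℕ< A a b p q with entries (fromℕ< p) (fromℕ< q)
  ...   | inj₁ z rewrite z = ℤ.+≤+ z≤n
  ...   | inj₂ (inj₁ o) rewrite o = ℤP.≤-refl
  ...   | inj₂ (inj₂ m) rewrite m = ℤ.-≤+
  rowSum : ∀ a → a ℕ.< n → Σ< n (pad A a) ≡ 1ℤ
  rowSum a p = trans (sym (sumFin-Σ< n (A (fromℕ< p)) (pad A a) (λ b q → pad-fromℕ< A a b p q))) (rowSums (fromℕ< p))
  alternating : ∀ b → Alternating (λ a → pad A a b)
  alternating b a a' a<a' nz nz' gap = begin
    pad A a' b                 ≡⟨ pad-fromℕ< A a' b a'n bn ⟩
    A i' j                     ≡⟨ colAlt j i i' i<i' (λ e → nz (trans (pad-fromℕ< A a b an bn) e))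
                                                      (λ e → nz' (trans (pad-fromℕ< A a' b a'n bn) e)) gap′ ⟩
    - A i j                    ≡⟨ cong -_ (sym (pad-fromℕ< A a b an bn)) ⟩
    - pad A a b                ∎
    where
    open ≡-Reasoning
    an = proj₁ (pad-nonzero A a b nz)
    bn = proj₂ (pad-nonzero A a b nz)
    a'n = proj₁ (pad-nonzero A a' b nz')
    i = fromℕ< an
    i' = fromℕ< a'n
    j = fromℕ< bn
    i<i' : i F.< i'
    i<i' = subst₂ ℕ._<_ (sym (FP.toℕ-fromℕ< an)) (sym (FP.toℕ-fromℕ< a'n)) a<a'
    gap′ : ∀ l → i F.< l → l F.< i' → A l j ≡ 0ℤ
    gap′ l p q = trans (sym (trans (at-toℕ (λ i → at (A i) b) l) (at-fromℕ< (A l) b bn)))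
      (gap (toℕ l) (subst (ℕ._< toℕ l) (FP.toℕ-fromℕ< an) p) (subst (toℕ l ℕ.<_) (FP.toℕ-fromℕ< a'n) q))

permMat-one : ∀ {n} (w : Permutation′ n) i j → permMat w i j ≡ 1ℤ → w ⟨$⟩ʳ i ≡ j
permMat-one w i j e with w ⟨$⟩ʳ i F.≟ j
... | yes p = p
... | no _ = ⊥-elim (0≢1 e)

permMat-hit : ∀ {n} (w : Permutation′ n) i j → w ⟨$⟩ʳ i ≡ j → permMat w i j ≡ 1ℤ
permMat-hit w i j e with w ⟨$⟩ʳ i F.≟ j
... | yes _ = refl
... | no ne = ⊥-elim (ne e)

permMat-partialPerm : ∀ {n} (w : Permutation′ n) → IsPartialPerm (permMat w)
permMat-partialPerm w = zo , ru , cu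
  where
  zo : ∀ i j → permMat w i j ≡ 0ℤ ⊎ permMat w i j ≡ 1ℤ
  zo i j with w ⟨$⟩ʳ i F.≟ j
  ... | yes _ = inj₂ refl
  ... | no _ = inj₁ refl
  ru : ∀ i j j' → permMat w i j ≡ 1ℤ → permMat w i j' ≡ 1ℤ → j ≡ j'
  ru i j j' e e' = trans (sym (permMat-one w i j e)) (permMat-one w i j' e')
  cu : ∀ j i i' → permMat w i j ≡ 1ℤ → permMat w i' j ≡ 1ℤ → i ≡ i'
  cu j i i' e e' = trans (sym (inverseˡ w))
    (trans (cong (w ⟨$⟩ˡ_) (trans (permMat-one w i j e) (sym (permMat-one w i' j e')))) (inverseˡ w))

permMat-rowOne : ∀ {n} (w : Permutation′ n) → ∀ a → a ℕ.< n → ∃ λ b → b ℕ.< n × pad (permMat w) a b ≡ 1ℤ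
permMat-rowOne w a p = toℕ (w ⟨$⟩ʳ i) , FP.toℕ<n _ ,
  trans (pad-fromℕ< (permMat w) a _ p (FP.toℕ<n _)) (permMat-hit w i _ (sym (FP.fromℕ<-toℕ _ (FP.toℕ<n _))))
  where i = fromℕ< p

permMat-colOne : ∀ {n} (w : Permutation′ n) → ∀ b → b ℕ.< n → ∃ λ a → a ℕ.< n × pad (permMat w) a b ≡ 1ℤ
permMat-colOne w b q = toℕ (w ⟨$⟩ˡ j) , FP.toℕ<n _ ,
  trans (pad-fromℕ< (permMat w) _ b (FP.toℕ<n _) q)
        (permMat-hit w _ j (trans (cong (w ⟨$⟩ʳ_) (FP.fromℕ<-toℕ _ (FP.toℕ<n _))) (inverseʳ w)))
  where j = fromℕ< q

-- An injective endofunction of Fin n is surjective (pigeonhole principle).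
injective⇒surjective : ∀ {n} (f : Fin n → Fin n) → (∀ i i' → f i ≡ f i' → i ≡ i') → ∀ j → ∃ λ i → f i ≡ j
injective⇒surjective {suc m} f inj j with FP.any? (λ i → f i F.≟ j)
... | yes hit = hit
... | no missed with FP.pigeonhole (ℕP.n<1+n m) (λ i → F.punchOut {i = j} (λ e → missed (i , sym e)))
...   | i , i' , i<i' , e = ⊥-elim (FP.<⇒≢ i<i'
        (inj i i' (FP.punchOut-injective {i = j} (λ e' → missed (i , sym e')) (λ e' → missed (i' , sym e')) e)))

full⇒permutation : ∀ n M → PartialPermIn n M → Full n M → Σ (Permutation′ n) λ w → ∀ a b → pad (permMat w) a b ≡ M a b
full⇒permutation n M p full = w , agrees
  where
  open PartialPermIn p
  col : Fin n → ℕ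
  col i = proj₁ (full (toℕ i) (FP.toℕ<n i))
  col<n : ∀ i → col i ℕ.< n
  col<n i = proj₁ (proj₂ (full (toℕ i) (FP.toℕ<n i)))
  colOne : ∀ i → M (toℕ i) (col i) ≡ 1ℤ
  colOne i = proj₂ (proj₂ (full (toℕ i) (FP.toℕ<n i)))
  f : Fin n → Fin n
  f i = fromℕ< (col<n i)
  toℕ-f : ∀ i → toℕ (f i) ≡ col i
  toℕ-f i = FP.toℕ-fromℕ< (col<n i)
  f-injective : ∀ i i' → f i ≡ f i' → i ≡ i'
  f-injective i i' e = FP.toℕ-injective (colUnique (col i) _ _ (colOne i)
    (subst (λ z → M (toℕ i') z ≡ 1ℤ) (trans (sym (toℕ-f i')) (trans (cong toℕ (sym e)) (toℕ-f i))) (colOne i')))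
  g : Fin n → Fin n
  g j = proj₁ (injective⇒surjective f f-injective j)
  fg : ∀ j → f (g j) ≡ j
  fg j = proj₂ (injective⇒surjective f f-injective j)
  w : Permutation′ n
  w = permutation f g fg (λ i → f-injective _ _ (fg (f i)))
  agrees : ∀ a b → pad (permMat w) a b ≡ M a b
  agrees a b with inRange? n a b
  ... | inj₂ o = trans (pad-supp (permMat w) a b o) (sym (supp a b o))
  ... | inj₁ (p , q) = trans (pad-fromℕ< (permMat w) a b p q) (decide (f (fromℕ< p) F.≟ fromℕ< q))
    where
    i = fromℕ< p
    Mac : M a (col i) ≡ 1ℤ
    Mac = subst (λ z → M z (col i) ≡ 1ℤ) (FP.toℕ-fromℕ< p) (colOne i)
    decide : (d : Dec (f i ≡ fromℕ< q)) → (if ⌊ d ⌋ then 1ℤ else 0ℤ) ≡ M a b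
    decide (yes e) = sym (subst (λ z → M a z ≡ 1ℤ) (trans (sym (toℕ-f i)) (trans (cong toℕ e) (FP.toℕ-fromℕ< q))) Mac)
    decide (no ne) with zeroOne a b
    ... | inj₁ z = sym z
    ... | inj₂ o = ⊥-elim (ne (FP.toℕ-injective (trans (toℕ-f i) (trans (rowUnique a _ _ Mac o) (sym (FP.toℕ-fromℕ< q))))))

fillToPermutation : ∀ n U → ASMIn n U → ∀ M → PartialPermIn n M → RankBelow n M U →
  Σ (Permutation′ n) λ v → RankBelow n (pad (permMat v)) U × RankBelow n M (pad (permMat v))
fillToPermutation n U asm M p below
  with Filling.fill n U (ASMIn.rankBound asm) M p below
... | M* , p* , full* , below* , above* with full⇒permutation n M* p* full*
...   | v , agrees = v , (λ k l kn ln → subst₂ ℤ._≤_ (sym (rank-cong _ _ agrees k l)) refl (below* k l kn ln))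
                       , (λ k l kn ln → subst₂ ℤ._≤_ refl (sym (rank-cong _ _ agrees k l)) (above* k l kn ln))

permutationBetween : ∀ n (A : Mat n) → IsASM A → (Y : Mat n) → IsPartialPerm Y → A ≤M Y →
  Σ (Permutation′ n) λ v → A ≤M permMat v × permMat v ≤M Y
permutationBetween n A asm Y ppY AY = v , ≤ᵣ⇒≤M A V (≤ᵣ-fromBox n _ _ (pad-supp A) (pad-supp V) vA)
                                         , ≤ᵣ⇒≤M V Y (≤ᵣ-fromBox n _ _ (pad-supp V) (pad-supp Y) Yv)
  where
  filled : Σ (Permutation′ n) λ v → RankBelow n (pad (permMat v)) (pad A) × RankBelow n (pad Y) (pad (permMat v))
  filled = fillToPermutation n (pad A) (pad-ASM A asm) (pad Y) (pad-partialPerm Y ppY) (λ k l _ _ → ≤M⇒≤ᵣ A Y AY k l)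
  v : Permutation′ n
  v = proj₁ filled
  V : Mat n
  V = permMat v
  vA : RankBelow n (pad V) (pad A)
  vA = proj₁ (proj₂ filled)
  Yv : RankBelow n (pad Y) (pad V)
  Yv = proj₂ (proj₂ filled)

isPermMat⇒isPartialPerm : ∀ {n} {X : Mat n} → IsPermMat X → IsPartialPerm X
isPermMat⇒isPartialPerm {X = X} (w , e) = IsPartialPerm-resp (permMat w) X e (permMat-partialPerm w)

minimalPartialPerms : ∀ n (A : Mat n) → IsASM A → (W : Mat n) →
  MinIn (λ X → IsPartialPerm X × A ≤M X) W ⇔ InPerm A W
minimalPartialPerms n A asm W = mk⇔ to from
  where
  -- a minimal partial permutation equals the permutation the filling puts below it
  to : MinIn (λ X → IsPartialPerm X × A ≤M X) W → InPerm A W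
  to ((ppW , AW) , minW) = ((v , minW (permMat v) (permMat-partialPerm v , Av) vW) , AW) ,
                           λ Y (pY , AY) YW → minW Y (isPermMat⇒isPartialPerm pY , AY) YW
    where
    between : Σ (Permutation′ n) λ v → A ≤M permMat v × permMat v ≤M W
    between = permutationBetween n A asm W ppW AW
    v : Permutation′ n
    v = proj₁ between
    Av : A ≤M permMat v
    Av = proj₁ (proj₂ between)
    vW : permMat v ≤M W
    vW = proj₂ (proj₂ between)
  -- a partial permutation Y between A and W lies above a permutation u ≥ A, and u = W
  from : InPerm A W → MinIn (λ X → IsPartialPerm X × A ≤M X) W
  from ((pW , AW) , minW) = (isPermMat⇒isPartialPerm pW , AW) , minimal
    where
    minimal : ∀ Y → IsPartialPerm Y × A ≤M Y → Y ≤M W → Y ≡M W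
    minimal Y (ppY , AY) YW = ≤M-antisym Y W YW (≤M-trans (≡M⇒≤M W U (λ i j → sym (uW i j))) uY)
      where
      between : Σ (Permutation′ n) λ u → A ≤M permMat u × permMat u ≤M Y
      between = permutationBetween n A asm Y ppY AY
      U : Mat n
      U = permMat (proj₁ between)
      uY : U ≤M Y
      uY = proj₂ (proj₂ between)
      uW : U ≡M W
      uW = minW U ((proj₁ between , λ _ _ → refl) , proj₁ (proj₂ between)) (≤M-trans uY YW)

idFrom : ℕ → IMat
idFrom n a b = if ⌊ n ℕ.≤? a ⌋ then δ a b 1ℤ else 0ℤ

-- embed X = diag(X, 1, 1, …) for an n × n matrix X: the common value of
-- all its images under S_n ⊂ S_{n+1} ⊂ ⋯ (resp. ASM(n) ⊂ ASM(n+1) ⊂ ⋯).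
embed : ∀ {n} → Mat n → IMat
embed {n} X a b = pad X a b + idFrom n a b

embed-in : ∀ {n} (X : Mat n) a b → a ℕ.< n → embed X a b ≡ pad X a b
embed-in {n} X a b a<n with n ℕ.≤? a
... | yes n≤a = ⊥-elim (ℕP.<⇒≱ a<n n≤a)
... | no _ = ℤP.+-identityʳ _

embed-out : ∀ {n} (X : Mat n) L a b → n ℕ.≤ L → (L ℕ.≤ a ⊎ L ℕ.≤ b) → embed X a b ≡ δ a b 1ℤ
embed-out {n} X L a b n≤L o = trans (cong (_+ idFrom n a b) (pad-supp X a b outside)) (trans (ℤP.+-identityˡ _) diagonal)
  where
  outside : n ℕ.≤ a ⊎ n ℕ.≤ b
  outside = Data.Sum.map (ℕP.≤-trans n≤L) (ℕP.≤-trans n≤L) o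
  diagonal : idFrom n a b ≡ δ a b 1ℤ
  diagonal with n ℕ.≤? a
  ... | yes _ = refl
  ... | no n≰a = sym (δ-≢ a b 1ℤ (λ a≡b → [ ℕP.<⇒≱ a<L , (λ L≤b → ℕP.<⇒≱ a<L (subst (L ℕ.≤_) (sym a≡b) L≤b)) ] o))
    where a<L = ℕP.<-≤-trans (ℕP.≰⇒> n≰a) n≤L

embed-cases : ∀ {n} (X : Mat n) a b → (a ℕ.< n × b ℕ.< n × embed X a b ≡ pad X a b)
                                    ⊎ ((n ℕ.≤ a ⊎ n ℕ.≤ b) × embed X a b ≡ δ a b 1ℤ)
embed-cases {n} X a b with inRange? n a b
... | inj₁ (p , q) = inj₁ (p , q , embed-in X a b p)
... | inj₂ o = inj₂ (o , embed-out X n a b ℕP.≤-refl o)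

extTo-embed : ∀ {n} N (X : Mat n) (i j : Fin N) → extTo N X i j ≡ embed X (toℕ i) (toℕ j)
extTo-embed {n} N X i j with toℕ i ℕ.<? n | toℕ j ℕ.<? n
... | yes p | yes q = sym (trans (embed-in X _ _ p) (pad-fromℕ< X _ _ p q))
... | no p | _ = sym (embed-out X n _ _ ℕP.≤-refl (inj₁ (ℕP.≮⇒≥ p)))
... | yes p | no q = sym (embed-out X n _ _ ℕP.≤-refl (inj₂ (ℕP.≮⇒≥ q)))

pad-extTo : ∀ {n} N (X : Mat n) a b → a ℕ.< N → b ℕ.< N → pad (extTo N X) a b ≡ embed X a b
pad-extTo N X a b p q = trans (pad-fromℕ< (extTo N X) a b p q)
  (trans (extTo-embed N X _ _) (cong₂ (embed X) (FP.toℕ-fromℕ< p) (FP.toℕ-fromℕ< q)))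

rank-extTo : ∀ {n} N (X : Mat n) k l → k ℕ.≤ N → l ℕ.≤ N → rank (pad (extTo N X)) k l ≡ rank (embed X) k l
rank-extTo N X k l kN lN = Σ<-cong k (λ a p → Σ<-cong l (λ b q →
  pad-extTo N X a b (ℕP.<-≤-trans p kN) (ℕP.<-≤-trans q lN)))

rank-idFrom : ∀ n k l → rank (idFrom n) k l ≡ + (k ⊓ l ∸ n)
rank-idFrom n k l = trans (Σ<-truncate k l g beyondCols) (count (k ⊓ l) (ℕP.m⊓n≤n k l))
  where
  g : ℕ → ℤ
  g a = Σ< l (idFrom n a)
  beyondCols : ∀ a → l ℕ.≤ a → g a ≡ 0ℤ
  beyondCols a la with n ℕ.≤? a
  ... | yes _ = Σ<-δ-out l a 1ℤ la
  ... | no _ = Σ<-zero l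
  below : ∀ a → a ℕ.< n → g a ≡ 0ℤ
  below a an = Σ<-vanish l _ λ b _ → lem b
    where lem : ∀ b → idFrom n a b ≡ 0ℤ
          lem b with n ℕ.≤? a
          ... | yes n≤a = ⊥-elim (ℕP.<⇒≱ an n≤a)
          ... | no _ = refl
  diagonal : ∀ a → n ℕ.≤ a → a ℕ.< l → g a ≡ 1ℤ
  diagonal a na al = trans (Σ<-cong l (λ b _ → lem b)) (Σ<-δ-in l a 1ℤ al)
    where lem : ∀ b → idFrom n a b ≡ δ a b 1ℤ
          lem b with n ℕ.≤? a
          ... | yes _ = refl
          ... | no n≰a = ⊥-elim (n≰a na)
  count : ∀ m → m ℕ.≤ l → Σ< m g ≡ + (m ∸ n)
  count m ml with ℕP.≤-total m n
  ... | inj₁ mn = trans (Σ<-vanish m g (λ a p → below a (ℕP.<-≤-trans p mn))) (cong +_ (sym (ℕP.m≤n⇒m∸n≡0 mn)))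
  ... | inj₂ nm = trans (Σ<-padOnes n m g nm (λ a p q → diagonal a p (ℕP.<-≤-trans q ml)))
                        (trans (cong (_+ + (m ∸ n)) (Σ<-vanish n g below)) (ℤP.+-identityˡ _))

rank-embed : ∀ {n} (X : Mat n) k l → rank (embed X) k l ≡ rank (pad X) k l + + (k ⊓ l ∸ n)
rank-embed {n} X k l = trans (rank-+ (pad X) (idFrom n) k l) (cong (_+_ (rank (pad X) k l)) (rank-idFrom n k l))

∸-splitAt : ∀ a L m → a ℕ.≤ L → m ∸ a ≡ (m ⊓ L ∸ a) ℕ.+ (m ∸ L)
∸-splitAt a L m a≤L with ℕP.≤-total m L
... | inj₁ m≤L rewrite ℕP.m≤n⇒m⊓n≡m m≤L | ℕP.m≤n⇒m∸n≡0 m≤L = sym (ℕP.+-identityʳ _)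
... | inj₂ L≤m rewrite ℕP.m≥n⇒m⊓n≡n L≤m = begin
    m ∸ a                 ≡⟨ cong (_∸ a) (sym (ℕP.m∸n+n≡m L≤m)) ⟩
    (m ∸ L) ℕ.+ L ∸ a     ≡⟨ ℕP.+-∸-assoc (m ∸ L) a≤L ⟩
    (m ∸ L) ℕ.+ (L ∸ a)   ≡⟨ ℕP.+-comm (m ∸ L) (L ∸ a) ⟩
    (L ∸ a) ℕ.+ (m ∸ L)   ∎
  where open ≡-Reasoning

⊓-⊓-same : ∀ k l L → (k ⊓ L) ⊓ (l ⊓ L) ≡ (k ⊓ l) ⊓ L
⊓-⊓-same k l L = begin
  (k ⊓ L) ⊓ (l ⊓ L)   ≡⟨ ℕP.⊓-assoc k L (l ⊓ L) ⟩
  k ⊓ (L ⊓ (l ⊓ L))   ≡⟨ cong (k ⊓_) (cong (L ⊓_) (ℕP.⊓-comm l L)) ⟩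
  k ⊓ (L ⊓ (L ⊓ l))   ≡⟨ cong (k ⊓_) (sym (ℕP.⊓-assoc L L l)) ⟩
  k ⊓ ((L ⊓ L) ⊓ l)   ≡⟨ cong (λ z → k ⊓ (z ⊓ l)) (ℕP.⊓-idem L) ⟩
  k ⊓ (L ⊓ l)         ≡⟨ cong (k ⊓_) (ℕP.⊓-comm L l) ⟩
  k ⊓ (l ⊓ L)         ≡⟨ sym (ℕP.⊓-assoc k l L) ⟩
  (k ⊓ l) ⊓ L         ∎
  where open ≡-Reasoning

rank-embed-level : ∀ {a} (X : Mat a) L k l → a ℕ.≤ L →
  rank (embed X) k l ≡ rank (embed X) (k ⊓ L) (l ⊓ L) + + (k ⊓ l ∸ L)
rank-embed-level {a} X L k l a≤L = begin
  rank (embed X) k l                                  ≡⟨ rank-embed X k l ⟩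
  rank P k l + + (k ⊓ l ∸ a)                          ≡⟨ cong₂ _+_ (rank-truncate L P k l suppL) (cong +_ split) ⟩
  rank P k′ l′ + + ((k′ ⊓ l′ ∸ a) ℕ.+ (k ⊓ l ∸ L))    ≡⟨ cong (_+_ (rank P k′ l′)) (ℤP.pos-+ (k′ ⊓ l′ ∸ a) (k ⊓ l ∸ L)) ⟩
  rank P k′ l′ + (+ (k′ ⊓ l′ ∸ a) + + (k ⊓ l ∸ L))    ≡⟨ sym (ℤP.+-assoc (rank P k′ l′) _ _) ⟩
  rank P k′ l′ + + (k′ ⊓ l′ ∸ a) + + (k ⊓ l ∸ L)      ≡⟨ cong (_+ + (k ⊓ l ∸ L)) (sym (rank-embed X k′ l′)) ⟩
  rank (embed X) k′ l′ + + (k ⊓ l ∸ L)                ∎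
  where
  open ≡-Reasoning
  P = pad X
  k′ = k ⊓ L
  l′ = l ⊓ L
  suppL : Supp L P
  suppL x y o = pad-supp X x y (Data.Sum.map (ℕP.≤-trans a≤L) (ℕP.≤-trans a≤L) o)
  split : k ⊓ l ∸ a ≡ (k′ ⊓ l′ ∸ a) ℕ.+ (k ⊓ l ∸ L)
  split = trans (∸-splitAt a L (k ⊓ l) a≤L) (cong (λ z → (z ∸ a) ℕ.+ (k ⊓ l ∸ L)) (sym (⊓-⊓-same k l L)))

≤∞⇒≤ᵣ : ∀ {a b} (X : Mat a) (Y : Mat b) → (a , X) ≤∞ (b , Y) → embed X ≤ᵣ embed Y
≤∞⇒≤ᵣ {a} {b} X Y h k l =
  subst₂ ℤ._≤_ (sym (rank-embed-level Y L k l (ℕP.m≤n⊔m a b))) (sym (rank-embed-level X L k l (ℕP.m≤m⊔n a b)))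
    (ℤP.+-monoˡ-≤ _ (subst₂ ℤ._≤_ (rank-extTo L Y _ _ (ℕP.m⊓n≤n k L) (ℕP.m⊓n≤n l L))
                                  (rank-extTo L X _ _ (ℕP.m⊓n≤n k L) (ℕP.m⊓n≤n l L))
                                  (≤M⇒≤ᵣ (extTo L X) (extTo L Y) h (k ⊓ L) (l ⊓ L))))
  where L = a ⊔ b

≤ᵣ⇒≤∞ : ∀ {a b} (X : Mat a) (Y : Mat b) → embed X ≤ᵣ embed Y → (a , X) ≤∞ (b , Y)
≤ᵣ⇒≤∞ {a} {b} X Y h = ≤ᵣ⇒≤M (extTo L X) (extTo L Y) (≤ᵣ-fromBox L _ _ (pad-supp _) (pad-supp _)
   (λ k l kL lL → subst₂ ℤ._≤_ (sym (rank-extTo L Y k l kL lL)) (sym (rank-extTo L X k l kL lL)) (h k l)))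
  where L = a ⊔ b

_≐_ : IMat → IMat → Set
M ≐ N = ∀ a b → M a b ≡ N a b

≈∞⇒≐ : ∀ {a b} (X : Mat a) (Y : Mat b) → (a , X) ≈∞ (b , Y) → embed X ≐ embed Y
≈∞⇒≐ {a} {b} X Y h r c with inRange? (a ⊔ b) r c
... | inj₁ (p , q) = trans (sym (pad-extTo _ X r c p q)) (trans (pad-cong _ _ h r c) (pad-extTo _ Y r c p q))
... | inj₂ o = trans (embed-out X (a ⊔ b) r c (ℕP.m≤m⊔n a b) o) (sym (embed-out Y (a ⊔ b) r c (ℕP.m≤n⊔m a b) o))

≐⇒≈∞ : ∀ {a b} (X : Mat a) (Y : Mat b) → embed X ≐ embed Y → (a , X) ≈∞ (b , Y)
≐⇒≈∞ {a} {b} X Y h = pad-injective (extTo L X) (extTo L Y) agree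
  where
  L = a ⊔ b
  agree : ∀ r c → pad (extTo L X) r c ≡ pad (extTo L Y) r c
  agree r c with inRange? L r c
  ... | inj₁ (p , q) = trans (pad-extTo L X r c p q) (trans (h r c) (sym (pad-extTo L Y r c p q)))
  ... | inj₂ o = trans (pad-supp _ r c o) (sym (pad-supp _ r c o))

≤M⇒≤ᵣembed : ∀ {n} (X Y : Mat n) → X ≤M Y → embed X ≤ᵣ embed Y
≤M⇒≤ᵣembed X Y h k l = subst₂ ℤ._≤_ (sym (rank-embed Y k l)) (sym (rank-embed X k l)) (ℤP.+-monoˡ-≤ _ (≤M⇒≤ᵣ X Y h k l))

≤ᵣembed⇒≤M : ∀ {n} (X Y : Mat n) → embed X ≤ᵣ embed Y → X ≤M Y
≤ᵣembed⇒≤M X Y h = ≤ᵣ⇒≤M X Y (λ k l → +-cancelʳ-≤ _ (subst₂ ℤ._≤_ (rank-embed Y k l) (rank-embed X k l) (h k l)))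

≡M⇒≐ : ∀ {n} (X Y : Mat n) → X ≡M Y → embed X ≐ embed Y
≡M⇒≐ {n} X Y h r c = cong (_+ idFrom n r c) (pad-cong X Y h r c)

≐⇒≡M : ∀ {n} (X Y : Mat n) → embed X ≐ embed Y → X ≡M Y
≐⇒≡M {n} X Y h = pad-injective X Y (λ r c → +-cancelʳ-≡ (idFrom n r c) (h r c))

embed-one : ∀ {n} (X : Mat n) a b → embed X a b ≡ 1ℤ → (a ℕ.< n × b ℕ.< n × pad X a b ≡ 1ℤ) ⊎ (a ≡ b × n ℕ.≤ a)
embed-one {n} X a b e with embed-cases X a b
... | inj₁ (p , q , e′) = inj₁ (p , q , trans (sym e′) e)
... | inj₂ (o , e′) with δ-1 a b (trans (sym e′) e)
...   | refl = inj₂ (refl , [ (λ z → z) , (λ z → z) ]′ o)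

embed-partialPerm : ∀ {n} (X : Mat n) → PartialPermIn n (pad X) → PartialPerm (embed X)
embed-partialPerm {n} X p = record { zeroOne = zo ; rowUnique = ru ; colUnique = cu }
  where
  open PartialPermIn p
  zo : ∀ a b → embed X a b ≡ 0ℤ ⊎ embed X a b ≡ 1ℤ
  zo a b with embed-cases X a b
  ... | inj₁ (_ , _ , e) rewrite e = zeroOne a b
  ... | inj₂ (_ , e) rewrite e = δ-01 a b
  ru : ∀ a b b' → embed X a b ≡ 1ℤ → embed X a b' ≡ 1ℤ → b ≡ b'
  ru a b b' e e' with embed-one X a b e | embed-one X a b' e'
  ... | inj₁ (_ , _ , o) | inj₁ (_ , _ , o′) = rowUnique a b b' o o′
  ... | inj₁ (a<n , _ , _) | inj₂ (_ , n≤a) = ⊥-elim (ℕP.<⇒≱ a<n n≤a)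
  ... | inj₂ (_ , n≤a) | inj₁ (a<n , _ , _) = ⊥-elim (ℕP.<⇒≱ a<n n≤a)
  ... | inj₂ (refl , _) | inj₂ (refl , _) = refl
  cu : ∀ b a a' → embed X a b ≡ 1ℤ → embed X a' b ≡ 1ℤ → a ≡ a'
  cu b a a' e e' with embed-one X a b e | embed-one X a' b e'
  ... | inj₁ (_ , _ , o) | inj₁ (_ , _ , o′) = colUnique b a a' o o′
  ... | inj₁ (_ , b<n , _) | inj₂ (refl , n≤b) = ⊥-elim (ℕP.<⇒≱ b<n n≤b)
  ... | inj₂ (refl , n≤b) | inj₁ (_ , b<n , _) = ⊥-elim (ℕP.<⇒≱ b<n n≤b)
  ... | inj₂ (refl , _) | inj₂ (refl , _) = refl

isPermMat⇒partialPermIn : ∀ {n} {W : Mat n} → IsPermMat W → PartialPermIn n (pad W)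
isPermMat⇒partialPermIn {W = W} pW = pad-partialPerm W (isPermMat⇒isPartialPerm pW)

⊓-split : ∀ n k l → n ℕ.≤ l → (k ⊓ n) ℕ.+ (k ⊓ l ∸ n) ≡ k ⊓ l
⊓-split n k l n≤l with ℕP.≤-total k n
... | inj₁ k≤n rewrite ℕP.m≤n⇒m⊓n≡m k≤n | ℕP.m≤n⇒m⊓n≡m (ℕP.≤-trans k≤n n≤l) | ℕP.m≤n⇒m∸n≡0 k≤n = ℕP.+-identityʳ k
... | inj₂ n≤k rewrite ℕP.m≥n⇒m⊓n≡n n≤k = ℕP.m+[n∸m]≡n (ℕP.⊓-glb n≤k n≤l)

rank-embedPerm : ∀ {n} (w : Permutation′ n) k l → (n ℕ.≤ k ⊎ n ℕ.≤ l) → rank (embed (permMat w)) k l ≡ + (k ⊓ l)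
rank-embedPerm {n} w k l o = trans (rank-embed V k l)
  (trans (cong (_+ + (k ⊓ l ∸ n)) (rank-truncate n (pad V) k l (pad-supp V))) (byCase o))
  where
  V = permMat w
  open PartialPermIn (pad-partialPerm V (permMat-partialPerm w))
  rows : ∀ k′ → k′ ℕ.≤ n → rank (pad V) k′ n ≡ + k′
  rows k′ k′≤n = trans (Σ<-padOnes 0 k′ _ z≤n (λ a _ a<k′ →
      let (b , b<n , e) = permMat-rowOne w a (ℕP.<-≤-trans a<k′ k′≤n) in rowSum≡1 a n b b<n e))
    (ℤP.+-identityˡ _)
  cols : ∀ l′ → l′ ℕ.≤ n → rank (pad V) n l′ ≡ + l′
  cols l′ l′≤n = trans (rank-byColumns (pad V) n l′) (trans (Σ<-padOnes 0 l′ _ z≤n (λ b _ b<l′ →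
      let (a , a<n , e) = permMat-colOne w b (ℕP.<-≤-trans b<l′ l′≤n) in colSum≡1 b n a a<n e))
    (ℤP.+-identityˡ _))
  byCase : (n ℕ.≤ k ⊎ n ℕ.≤ l) → rank (pad V) (k ⊓ n) (l ⊓ n) + + (k ⊓ l ∸ n) ≡ + (k ⊓ l)
  byCase (inj₂ n≤l) rewrite ℕP.m≥n⇒m⊓n≡n n≤l =
    trans (cong (_+ + (k ⊓ l ∸ n)) (rows (k ⊓ n) (ℕP.m⊓n≤n k n)))
          (trans (sym (ℤP.pos-+ (k ⊓ n) (k ⊓ l ∸ n))) (cong +_ (⊓-split n k l n≤l)))
  byCase (inj₁ n≤k) rewrite ℕP.m≥n⇒m⊓n≡n n≤k =
    trans (cong (_+ + (k ⊓ l ∸ n)) (cols (l ⊓ n) (ℕP.m⊓n≤n l n)))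
          (trans (sym (ℤP.pos-+ (l ⊓ n) (k ⊓ l ∸ n)))
                 (cong +_ (trans (cong (λ z → (l ⊓ n) ℕ.+ (z ∸ n)) (ℕP.⊓-comm k l))
                                 (trans (⊓-split n l k n≤k) (ℕP.⊓-comm l k)))))

rank-embed-inBox : ∀ {n} (X : Mat n) k l → k ℕ.≤ n → rank (embed X) k l ≡ rank (pad X) k l
rank-embed-inBox X k l k≤n = trans (rank-embed X k l)
  (trans (cong (λ z → rank (pad X) k l + + z) (ℕP.m≤n⇒m∸n≡0 (ℕP.≤-trans (ℕP.m⊓n≤m k l) k≤n))) (ℤP.+-identityʳ _))

corner : ℕ → IMat → IMat
corner n G a b = if ⌊ a ℕ.<? n ⌋ then (if ⌊ b ℕ.<? n ⌋ then G a b else 0ℤ) else 0ℤ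

corner-cases : ∀ n G a b → (a ℕ.< n × b ℕ.< n × corner n G a b ≡ G a b) ⊎ ((n ℕ.≤ a ⊎ n ℕ.≤ b) × corner n G a b ≡ 0ℤ)
corner-cases n G a b with a ℕ.<? n | b ℕ.<? n
... | yes p | yes q = inj₁ (p , q , refl)
... | no p | _ = inj₂ (inj₁ (ℕP.≮⇒≥ p) , refl)
... | yes _ | no q = inj₂ (inj₂ (ℕP.≮⇒≥ q) , refl)

corner-partialPerm : ∀ n G → PartialPerm G → PartialPermIn n (corner n G)
corner-partialPerm n G p = record { supp = supp′ ; partialPerm = PartialPerm-sub p zo sub }
  where
  supp′ : Supp n (corner n G)
  supp′ a b o with corner-cases n G a b
  ... | inj₁ (a<n , b<n , _) = ⊥-elim ([ ℕP.<⇒≱ a<n , ℕP.<⇒≱ b<n ] o)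
  ... | inj₂ (_ , e) = e
  zo : ∀ a b → corner n G a b ≡ 0ℤ ⊎ corner n G a b ≡ 1ℤ
  zo a b with corner-cases n G a b
  ... | inj₁ (_ , _ , e) rewrite e = PartialPerm.zeroOne p a b
  ... | inj₂ (_ , e) = inj₁ e
  sub : ∀ a b → corner n G a b ≡ 1ℤ → G a b ≡ 1ℤ
  sub a b e with corner-cases n G a b
  ... | inj₁ (_ , _ , e′) = trans (sym e′) e
  ... | inj₂ (_ , e′) = ⊥-elim (0≢1 (trans (sym e′) e))

rank-corner : ∀ n G k l → k ℕ.≤ n → l ℕ.≤ n → rank (corner n G) k l ≡ rank G k l
rank-corner n G k l kn ln = Σ<-cong k (λ a p → Σ<-cong l (λ b q → inside a b (ℕP.<-≤-trans p kn) (ℕP.<-≤-trans q ln)))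
  where inside : ∀ a b → a ℕ.< n → b ℕ.< n → corner n G a b ≡ G a b
        inside a b p q with corner-cases n G a b
        ... | inj₁ (_ , _ , e) = e
        ... | inj₂ (o , _) = ⊥-elim ([ ℕP.<⇒≱ p , ℕP.<⇒≱ q ] o)

-- To see embed v ≤ G for a permutation v of size n and a partial permutation
-- G, it suffices to compare ranks on [0, n]²: beyond it, v is full.
embedPerm-≤ᵣ : ∀ {n} (v : Permutation′ n) G → PartialPerm G → RankBelow n G (pad (permMat v)) → embed (permMat v) ≤ᵣ G
embedPerm-≤ᵣ {n} v G pG box k l = [ (λ k≤n → [ (λ l≤n → inside k≤n l≤n) , (λ n≤l → outside (inj₂ n≤l)) ]′ (ℕP.≤-total l n)) ,
                                    (λ n≤k → outside (inj₁ n≤k)) ]′ (ℕP.≤-total k n)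
  where
  inside : k ℕ.≤ n → l ℕ.≤ n → rank G k l ℤ.≤ rank (embed (permMat v)) k l
  inside k≤n l≤n = subst₂ ℤ._≤_ refl (sym (rank-embed-inBox (permMat v) k l k≤n)) (box k l k≤n l≤n)
  outside : n ℕ.≤ k ⊎ n ℕ.≤ l → rank G k l ℤ.≤ rank (embed (permMat v)) k l
  outside o = subst₂ ℤ._≤_ refl (sym (rank-embedPerm v k l o)) (PartialPerm.rank≤min pG k l)

-- Main step for part (1): if w ∈ S_m lies above A, filling the n × n corner of
-- w gives v ∈ S_n with A ≤ v ≤ w in S_∞.
permutationBelow : ∀ n (A : Mat n) → IsASM A → ∀ m (W : Mat m) → IsPermMat W → embed A ≤ᵣ embed W →
  Σ (Permutation′ n) λ v → A ≤M permMat v × embed (permMat v) ≤ᵣ embed W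
permutationBelow n A asm m W pW AW = v , ≤ᵣ⇒≤M A V (≤ᵣ-fromBox n _ _ (pad-supp A) (pad-supp V) vA) , vW
  where
  globalW : PartialPerm (embed W)
  globalW = embed-partialPerm W (isPermMat⇒partialPermIn pW)
  cornerAbove : RankBelow n (corner n (embed W)) (pad A)
  cornerAbove k l kn ln = subst₂ ℤ._≤_ (sym (rank-corner n _ k l kn ln)) (rank-embed-inBox A k l kn) (AW k l)
  filled : Σ (Permutation′ n) λ v → RankBelow n (pad (permMat v)) (pad A) × RankBelow n (corner n (embed W)) (pad (permMat v))
  filled = fillToPermutation n (pad A) (pad-ASM A asm) (corner n (embed W)) (corner-partialPerm n _ globalW) cornerAbove
  v : Permutation′ n
  v = proj₁ filled
  V : Mat n
  V = permMat v
  vA : RankBelow n (pad V) (pad A)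
  vA = proj₁ (proj₂ filled)
  Wv : RankBelow n (corner n (embed W)) (pad V)
  Wv = proj₂ (proj₂ filled)
  vW : embed V ≤ᵣ embed W
  vW = embedPerm-≤ᵣ v (embed W) globalW (λ k l kn ln → subst₂ ℤ._≤_ (rank-corner n _ k l kn ln) refl (Wv k l kn ln))

embedPerm-rowOne : ∀ {n} (v : Permutation′ n) r → ∃ λ c → embed (permMat v) r c ≡ 1ℤ
embedPerm-rowOne {n} v r with r ℕ.<? n
... | yes r<n = let (c , _ , e) = permMat-rowOne v r r<n in c , trans (embed-in (permMat v) r c r<n) e
... | no r≮n = r , trans (embed-out (permMat v) n r r ℕP.≤-refl (inj₁ (ℕP.≮⇒≥ r≮n))) (δ-refl r 1ℤ)

isPermMat-fromEmbed : ∀ {n m} (V : Mat n) (W : Mat m) → IsPermMat V → embed V ≐ embed W → IsPermMat W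
isPermMat-fromEmbed {n} {m} V W (v , ev) VW = proj₁ perm , pad-injective _ W (proj₂ perm)
  where
  globalV : PartialPerm (embed V)
  globalV = embed-partialPerm V (isPermMat⇒partialPermIn (v , ev))
  zo : ∀ a b → pad W a b ≡ 0ℤ ⊎ pad W a b ≡ 1ℤ
  zo a b with inRange? m a b
  ... | inj₁ (a<m , _) rewrite sym (embed-in W a b a<m) | sym (VW a b) = PartialPerm.zeroOne globalV a b
  ... | inj₂ o = inj₁ (pad-supp W a b o)
  sub : ∀ a b → pad W a b ≡ 1ℤ → embed V a b ≡ 1ℤ
  sub a b e with inRange? m a b
  ... | inj₁ (a<m , _) = trans (VW a b) (trans (embed-in W a b a<m) e)
  ... | inj₂ o = ⊥-elim (0≢1 (trans (sym (pad-supp W a b o)) e))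
  ppW : PartialPermIn m (pad W)
  ppW = record { supp = pad-supp W ; partialPerm = PartialPerm-sub globalV zo sub }
  full : Full m (pad W)
  full r r<m with embedPerm-rowOne v r
  ... | c , e with embed-one W r c (trans (sym (VW r c)) (trans (sym (≡M⇒≐ (permMat v) V ev r c)) e))
  ...   | inj₁ (_ , c<m , o) = c , c<m , o
  ...   | inj₂ (_ , m≤r) = ⊥-elim (ℕP.<⇒≱ r<m m≤r)
  perm : Σ (Permutation′ m) λ w → ∀ a b → pad (permMat w) a b ≡ pad W a b
  perm = full⇒permutation m (pad W) ppW full

-- A minimal w ∈ S_∞ above A equals the permutation v ∈ S_n that the filling
-- puts below it, and v ∈ Perm(A).
minimal⇒inPerm : ∀ n (A : Mat n) → IsASM A → ∀ m (W : Mat m) →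
  MinS∞Above (n , A) (m , W) → Σ (Mat n) (λ V → InPerm A V × (n , V) ≈∞ (m , W))
minimal⇒inPerm n A asm m W ((pW , AW) , minW) = V , (((v , λ _ _ → refl) , Av) , minV) , ≐⇒≈∞ V W VW
  where
  below : Σ (Permutation′ n) λ v → A ≤M permMat v × embed (permMat v) ≤ᵣ embed W
  below = permutationBelow n A asm m W pW (≤∞⇒≤ᵣ A W AW)
  v : Permutation′ n
  v = proj₁ below
  V : Mat n
  V = permMat v
  Av : A ≤M V
  Av = proj₁ (proj₂ below)
  VW : embed V ≐ embed W
  VW = ≈∞⇒≐ V W (minW (n , V) (v , λ _ _ → refl) (≤ᵣ⇒≤∞ A V (≤M⇒≤ᵣembed A V Av)) (≤ᵣ⇒≤∞ V W (proj₂ (proj₂ below))))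
  minV : ∀ Y → IsPermMat Y × A ≤M Y → Y ≤M V → Y ≡M V
  minV Y (pY , AY) YV = ≐⇒≡M Y V (λ r c → trans (YW′ r c) (sym (VW r c)))
    where
    YW : embed Y ≤ᵣ embed W
    YW k l = subst₂ ℤ._≤_ (rank-cong _ _ VW k l) refl (≤M⇒≤ᵣembed Y V YV k l)
    YW′ : embed Y ≐ embed W
    YW′ = ≈∞⇒≐ Y W (minW (n , Y) pY (≤ᵣ⇒≤∞ A Y (≤M⇒≤ᵣembed A Y AY)) (≤ᵣ⇒≤∞ Y W YW))

-- Conversely, the image of V ∈ Perm(A) is minimal in S_∞: any y between A and
-- it lies above some u ∈ S_n with u ≥ A, and minimality of V forces u = V = y.
inPerm⇒minimal : ∀ n (A : Mat n) → IsASM A → ∀ m (W : Mat m) →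
  Σ (Mat n) (λ V → InPerm A V × (n , V) ≈∞ (m , W)) → MinS∞Above (n , A) (m , W)
inPerm⇒minimal n A asm m W (V , ((pV , AV) , minV) , V≈W) = (isPermMat-fromEmbed V W pV VW , AW) , minimal
  where
  VW : embed V ≐ embed W
  VW = ≈∞⇒≐ V W V≈W
  AW : (n , A) ≤∞ (m , W)
  AW = ≤ᵣ⇒≤∞ A W (λ k l → subst₂ ℤ._≤_ (rank-cong _ _ VW k l) refl (≤M⇒≤ᵣembed A V AV k l))
  minimal : ∀ Y → InS∞ Y → (n , A) ≤∞ Y → Y ≤∞ (m , W) → Y ≈∞ (m , W)
  minimal (b , Y) pY AY Y≤W = ≐⇒≈∞ Y W (rank-injective _ _ λ k l → ℤP.≤-antisym (YW k l) (Y≤W′ k l))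
    where
    below : Σ (Permutation′ n) λ u → A ≤M permMat u × embed (permMat u) ≤ᵣ embed Y
    below = permutationBelow n A asm b Y pY (≤∞⇒≤ᵣ A Y AY)
    U : Mat n
    U = permMat (proj₁ below)
    uY : embed U ≤ᵣ embed Y
    uY = proj₂ (proj₂ below)
    Y≤W′ : embed Y ≤ᵣ embed W
    Y≤W′ = ≤∞⇒≤ᵣ Y W Y≤W
    UV : U ≡M V
    UV = minV U ((proj₁ below , λ _ _ → refl) , proj₁ (proj₂ below))
      (≤ᵣembed⇒≤M U V (λ k l → ℤP.≤-trans (subst₂ ℤ._≤_ (sym (rank-cong _ _ VW k l)) refl (Y≤W′ k l)) (uY k l)))
    YW : ∀ k l → rank (embed Y) k l ℤ.≤ rank (embed W) k l
    YW k l = subst₂ ℤ._≤_ refl (trans (rank-cong _ _ (≡M⇒≐ U V UV) k l) (rank-cong _ _ VW k l)) (uY k l)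

corollary4p7 : (n : ℕ) (A : Mat n) → IsASM A →
    ((m : ℕ) (W : Mat m) →
      MinS∞Above (n , A) (m , W)
        ⇔ Σ (Mat n) (λ V → InPerm A V × (n , V) ≈∞ (m , W)))
    × ((W : Mat n) →
      MinIn (λ X → IsPartialPerm X × A ≤M X) W ⇔ InPerm A W)
corollary4p7 n A asm = (λ m W → mk⇔ (minimal⇒inPerm n A asm m W) (inPerm⇒minimal n A asm m W))
                     , minimalPartialPerms n A asm
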